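{- Let $b \geq 2$, $m \geq 1$ be integers with $b \not\equiv 1 \pmod m$, and let $w$ be a bispecial factor of $\mathbf t_{b,m}$ with $1 \leq |w| < 2b$. Let $\Theta \in D_m$ be the unique antimorphism in $D_m$ with $\Theta(w) = w$. Then: (i) if $1 \leq |w| \leq b-1$, then ${\rm b}(w)=0$ and $\#\mathrm{Pext}_\Theta(w)=1$; (ii) if $|w| = b$, then ${\rm b}(w)=1$ and $\#\mathrm{Pext}_\Theta(w)=2$; (iii) if $b+1 \leq |w| \leq 2b-2$, then ${\rm b}(w)=0$ and $\#\mathrm{Pext}_\Theta(w)=1$; (iv) if $|w| = 2b-1$, then ${\rm b}(w)=-1$ and $\#\mathrm{Pext}_\Theta(w)=0$.
   Context: For an integer $n \geq 0$, $s_b(n)$ denotes the sum of digits of the base-$b$ representation of $n$. The generalized Thue-Morse word is $\mathbf t_{b,m} = (s_b(n) \bmod m)_{n=0}^{+\infty}$ over the alphabet $\mathbb Z_m$; its language is its set of finite factors. For $x\in\mathbb Z_m$, $\Psi_x$ is the antimorphism of $\mathbb Z_m^*$ with $\Psi_x(k)=x-k$ and $\Pi_x$ the morphism with $\Pi_x(k)=x+k$ on letters (mod $m$); $D_m=\{\Psi_x\}_{x\in\mathbb Z_m}\cup\{\Pi_x\}_{x\in\mathbb Z_m}$. For an antimorphism $\Theta$, a word $w$ with $\Theta(w)=w$ is a $\Theta$-palindrome. For a factor $w$ of an infinite word $\mathbf u$: $\mathrm{Lext}(w)=\{a : aw\in\mathcal L(\mathbf u)\}$, $\mathrm{Rext}(w)=\{a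 : wa\in\mathcal L(\mathbf u)\}$, $\mathrm{Bext}(w)=\{awb\in\mathcal L(\mathbf u): a,b \text{ letters}\}$; $w$ is bispecial if $\#\mathrm{Lext}(w)\ge 2$ and $\#\mathrm{Rext}(w)\geq 2$; its bilateral order is ${\rm b}(w)=\#\mathrm{Bext}(w)-\#\mathrm{Lext}(w)-\#\mathrm{Rext}(w)+1$. For a $\Theta$-palindrome $w$, $\mathrm{Pext}_\Theta(w)=\{aw\Theta(a)\in\mathcal L(\mathbf u): a \text{ a letter}\}$. -}

module Defs where

open import Data.Nat using (ℕ; zero; suc; _+_; _*_; _∸_; _≤_; _<_)
open import Data.Nat.DivMod using (_%_; _/_)
open import Data.List using (List; []; _∷_; _++_; [_]; length; map; reverse; upTo)
open import Data.List.Membership.Propositional using (_∈_)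
open import Data.List.Relation.Unary.Unique.Propositional using (Unique)
open import Data.Product using (Σ; ∃; ∃-syntax; _×_; _,_)
open import Data.Integer as ℤ using (ℤ; +_; 1ℤ)
open import Function.Bundles using (_⇔_)
open import Relation.Binary.PropositionalEquality using (_≡_)

-- n mod m (for m ≥ 1; for m = 0 we return n, never used)
modℕ : ℕ → ℕ → ℕ
modℕ zero n = n
modℕ (suc k) n = n % suc k

-- digit sum in base b with fuel (fuel n suffices for n)
digitSumFuel : ℕ → ℕ → ℕ → ℕ
digitSumFuel b zero n = 0
digitSumFuel zero (suc f) n = 0
digitSumFuel (suc b) (suc f) n = n % suc b + digitSumFuel (suc b) f (n / suc b)

s : ℕ → ℕ → ℕ
s b n = digitSumFuel b n n

-- generalized Thue–Morse word t_{b,m}; letters of Z_m are 0,…,m-1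
t : ℕ → ℕ → ℕ → ℕ
t b m n = modℕ m (s b n)

factorAt : ℕ → ℕ → ℕ → ℕ → List ℕ
factorAt b m i len = map (λ j → t b m (i + j)) (upTo len)

InL : ℕ → ℕ → List ℕ → Set
InL b m w = ∃[ i ] (factorAt b m i (length w) ≡ w)

Letter : ℕ → ℕ → Set
Letter m a = a < m

Ψ : ℕ → ℕ → List ℕ → List ℕ
Ψ m x w = reverse (map (λ k → modℕ m (x + (m ∸ k))) w)

HasCard : {A : Set} → (A → Set) → ℕ → Set
HasCard {A} P k = Σ (List A) λ l → Unique l × (∀ a → (a ∈ l) ⇔ P a) × length l ≡ k

Lext Rext : ℕ → ℕ → List ℕ → ℕ → Set
Lext b m w a = Letter m a × InL b m (a ∷ w)
Rext b m w a = Letter m a × InL b m (w ++ [ a ])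

-- elements a w c of Bext(w), indexed by the pair (a , c)
Bext : ℕ → ℕ → List ℕ → ℕ × ℕ → Set
Bext b m w (a , c) = Letter m a × Letter m c × InL b m (a ∷ w ++ [ c ])

-- elements a w Ψ_x(a) of Pext_{Ψ_x}(w), indexed by the letter a
Pext : ℕ → ℕ → ℕ → List ℕ → ℕ → Set
Pext b m x w a = Letter m a × InL b m (a ∷ w ++ Ψ m x [ a ])

Bispecial : ℕ → ℕ → List ℕ → Set
Bispecial b m w = InL b m w
  × (∃[ k ] (HasCard (Lext b m w) k × 2 ≤ k))
  × (∃[ k ] (HasCard (Rext b m w) k × 2 ≤ k))

BilOrder : ℕ → ℕ → List ℕ → ℤ → Set
BilOrder b m w r = ∃[ kB ] ∃[ kL ] ∃[ kR ]
  (HasCard (Bext b m w) kB × HasCard (Lext b m w) kL × HasCard (Rext b m w) kR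
   × ((+ kB) ℤ.- (+ kL) ℤ.- (+ kR) ℤ.+ 1ℤ ≡ r))

PextCard : ℕ → ℕ → ℕ → List ℕ → ℕ → Set
PextCard b m x w k = HasCard (Pext b m x w) k

-- Read at position i, a factor of t_{b,m} of length < 2b steps up by 1 (mod m) except after a position
-- i + j ending in the digit b - 1, where the digit sum drops by (b - 1) J - 1, J being the number of trailing
-- digits b - 1 (the carries). Such positions are exactly b apart, so a bispecial w is a run w₀, w₀ + 1, ...,
-- and a letter a before, resp. c after, an occurrence is fixed by the number J of carries at that end:
-- a + 1 ≡ w₀ + (b - 1) J, resp. w₀ + |w| ≡ c + (b - 1) J. Conversely every admissible pair of carry counts is
-- realised, by starting just before a number with the prescribed trailing digits and then writing extra high
-- digits that shift all digit sums of the window by the same amount. Since b ≢ 1 (mod m) a single carry is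
-- visible, which rules out a single carry strictly inside w; counting the admissible pairs in each range of |w|
-- gives the bilateral orders, and a w Ψ_x(a) is a factor exactly when its two carry counts agree.

module Submission where

open import Defs
open import Data.Nat
open import Data.Nat.Properties
open import Data.Nat.DivMod
open import Data.Nat.Induction using (<-rec)
open import Data.Nat.Tactic.RingSolver using (solve-∀)
open import Data.Fin using (Fin; toℕ; fromℕ<)
open import Data.Fin.Properties using (any?; toℕ-fromℕ<)
open import Data.Integer as ℤ using (ℤ; 0ℤ; 1ℤ; -1ℤ)
open import Data.Integer.Properties using (pos-+)
import Data.Integer.Tactic.RingSolver as ℤ-Solver
open import Data.List using (List; []; _∷_; _++_; [_]; length; map; reverse; applyUpTo; upTo)
open import Data.List.Properties using (∷-injectiveˡ; ∷-injectiveʳ; length-++; length-map; map-upTo; unfold-reverse; length-reverse)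
open import Data.List.Membership.Propositional using (_∈_)
open import Data.List.Membership.Propositional.Properties using (∈-map⁺; ∈-map⁻; ∈-++⁺ˡ; ∈-++⁺ʳ; ∈-++⁻)
open import Data.List.Relation.Unary.Any using (here; there)
open import Data.List.Relation.Unary.All using (All; []; _∷_)
open import Data.List.Relation.Unary.AllPairs using ([]; _∷_)
import Data.List.Relation.Unary.Unique.Propositional.Properties as Unique
open import Data.Product using (∃; _×_; _,_; proj₁; proj₂)
open import Data.Sum using (_⊎_; inj₁; inj₂; [_,_]′)
open import Data.Empty using (⊥; ⊥-elim)
open import Relation.Nullary using (¬_; Dec; yes; no)
open import Relation.Nullary.Decidable using (_×-dec_; ¬?)
open import Relation.Binary.Bundles using (Setoid)
import Relation.Binary.Reasoning.Setoid
open import Relation.Binary.Definitions using (tri<; tri≈; tri>)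
open import Relation.Binary.PropositionalEquality hiding ([_])
open import Function.Bundles using (_⇔_; mk⇔; Equivalence)

open Equivalence using (to; from)

-- out-of-range positions read 0; every use below is guarded by a bound on the position
nth : List ℕ → ℕ → ℕ
nth [] j = 0
nth (x ∷ l) zero = x
nth (x ∷ l) (suc j) = nth l j

nth-++ˡ : ∀ l l' j → j < length l → nth (l ++ l') j ≡ nth l j
nth-++ˡ (x ∷ l) l' zero _ = refl
nth-++ˡ (x ∷ l) l' (suc j) (s≤s j<) = nth-++ˡ l l' j j<

nth-∷ʳ-last : ∀ l c → nth (l ++ [ c ]) (length l) ≡ c
nth-∷ʳ-last [] c = refl
nth-∷ʳ-last (x ∷ l) c = nth-∷ʳ-last l c

nth-map : ∀ (g : ℕ → ℕ) l j → j < length l → nth (map g l) j ≡ g (nth l j)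
nth-map g (x ∷ l) zero _ = refl
nth-map g (x ∷ l) (suc j) (s≤s j<) = nth-map g l j j<

nth-reverse-head : ∀ y ys → nth (reverse (y ∷ ys)) 0 ≡ nth (y ∷ ys) (length ys)
nth-reverse-head y [] = refl
nth-reverse-head y (z ∷ zs) = begin
  nth (reverse (y ∷ z ∷ zs)) 0      ≡⟨ cong (λ u → nth u 0) (unfold-reverse y (z ∷ zs)) ⟩
  nth (reverse (z ∷ zs) ++ [ y ]) 0 ≡⟨ nth-++ˡ (reverse (z ∷ zs)) [ y ] 0 0<len ⟩
  nth (reverse (z ∷ zs)) 0          ≡⟨ nth-reverse-head z zs ⟩
  nth (z ∷ zs) (length zs)          ∎
  where
  open ≡-Reasoning
  0<len : 0 < length (reverse (z ∷ zs))
  0<len = subst (0 <_) (sym (length-reverse (z ∷ zs))) (s≤s z≤n)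

reverse-map-fixed⇒head≡ : ∀ (g : ℕ → ℕ) y ys → reverse (map g (y ∷ ys)) ≡ y ∷ ys → y ≡ g (nth (y ∷ ys) (length ys))
reverse-map-fixed⇒head≡ g y ys fixed = begin
  y                                         ≡⟨ cong (λ u → nth u 0) (sym fixed) ⟩
  nth (reverse (map g (y ∷ ys))) 0          ≡⟨ nth-reverse-head (g y) (map g ys) ⟩
  nth (map g (y ∷ ys)) (length (map g ys))  ≡⟨ cong (nth (map g (y ∷ ys))) (length-map g ys) ⟩
  nth (map g (y ∷ ys)) (length ys)          ≡⟨ nth-map g (y ∷ ys) (length ys) ≤-refl ⟩
  g (nth (y ∷ ys) (length ys))              ∎
  where open ≡-Reasoning

applyUpTo≡⇒nth : ∀ (h : ℕ → ℕ) l → applyUpTo h (length l) ≡ l → ∀ j → j < length l → h j ≡ nth l j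
applyUpTo≡⇒nth h (x ∷ l) e zero _ = ∷-injectiveˡ e
applyUpTo≡⇒nth h (x ∷ l) e (suc j) (s≤s j<) = applyUpTo≡⇒nth (λ k → h (suc k)) l (∷-injectiveʳ e) j j<

nth⇒applyUpTo≡ : ∀ (h : ℕ → ℕ) l → (∀ j → j < length l → h j ≡ nth l j) → applyUpTo h (length l) ≡ l
nth⇒applyUpTo≡ h [] _ = refl
nth⇒applyUpTo≡ h (x ∷ l) p = cong₂ _∷_ (p 0 (s≤s z≤n)) (nth⇒applyUpTo≡ (λ k → h (suc k)) l (λ j j< → p (suc j) (s≤s j<)))

module Occurrences (f : ℕ → ℕ) where

  OccursAt : ℕ → List ℕ → Set
  OccursAt i l = ∀ j → j < length l → f (i + j) ≡ nth l j

  factor≡⇔OccursAt : ∀ i l → map (λ j → f (i + j)) (upTo (length l)) ≡ l ⇔ OccursAt i l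
  factor≡⇔OccursAt i l = mk⇔
    (λ e → applyUpTo≡⇒nth (λ j → f (i + j)) l (trans (sym (map-upTo _ (length l))) e))
    (λ o → trans (map-upTo _ (length l)) (nth⇒applyUpTo≡ (λ j → f (i + j)) l o))

  occursAt-∷⁻ : ∀ i a l → OccursAt i (a ∷ l) → f i ≡ a × OccursAt (suc i) l
  occursAt-∷⁻ i a l o =
    subst (λ z → f z ≡ a) (+-identityʳ i) (o 0 (s≤s z≤n)) ,
    λ j j< → subst (λ z → f z ≡ nth l j) (+-suc i j) (o (suc j) (s≤s j<))

  occursAt-∷⁺ : ∀ i a l → f i ≡ a → OccursAt (suc i) l → OccursAt i (a ∷ l)
  occursAt-∷⁺ i a l e o zero _ = trans (cong f (+-identityʳ i)) e
  occursAt-∷⁺ i a l e o (suc j) (s≤s j<) = trans (cong f (+-suc i j)) (o j j<)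

  occursAt-∷ʳ⁻ : ∀ i l c → OccursAt i (l ++ [ c ]) → OccursAt i l × f (i + length l) ≡ c
  occursAt-∷ʳ⁻ i l c o =
    (λ j j< → trans (o j (lt (<⇒≤ j<))) (nth-++ˡ l [ c ] j j<)) ,
    trans (o (length l) (lt ≤-refl)) (nth-∷ʳ-last l c)
    where
    lt : ∀ {j} → j ≤ length l → j < length (l ++ [ c ])
    lt {j} j≤ = subst (j <_) (sym (trans (length-++ l) (+-comm (length l) 1))) (s≤s j≤)

  occursAt-∷ʳ⁺ : ∀ i l c → OccursAt i l → f (i + length l) ≡ c → OccursAt i (l ++ [ c ])
  occursAt-∷ʳ⁺ i l c o e j j< with <-cmp j (length l)
  ... | tri< lt _ _ = trans (o j lt) (sym (nth-++ˡ l [ c ] j lt))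
  ... | tri≈ _ refl _ = trans e (sym (nth-∷ʳ-last l c))
  ... | tri> _ _ gt = ⊥-elim (<-irrefl refl (≤-trans j< (subst (_≤ j) (sym len) gt)))
    where
    len : length (l ++ [ c ]) ≡ suc (length l)
    len = trans (length-++ l) (+-comm (length l) 1)

-- Digit sums in base B = b0 + 2, whose largest digit is suc b0

module DigitSum (b0 : ℕ) where

  B : ℕ
  B = suc (suc b0)

  digitSumFuel-0 : ∀ f → digitSumFuel B f 0 ≡ 0
  digitSumFuel-0 zero = refl
  digitSumFuel-0 (suc f) = digitSumFuel-0 f

  [1+n]/B<1+n : ∀ n → suc n / B < suc n
  [1+n]/B<1+n n = m/n<m (suc n) B (s≤s (s≤s z≤n))

  digitSumFuel-enough : ∀ f g n → n ≤ f → n ≤ g → digitSumFuel B f n ≡ digitSumFuel B g n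
  digitSumFuel-enough f g zero _ _ = trans (digitSumFuel-0 f) (sym (digitSumFuel-0 g))
  digitSumFuel-enough (suc f) (suc g) (suc n) (s≤s n≤f) (s≤s n≤g) =
    cong (suc n % B +_) (digitSumFuel-enough f g (suc n / B) (≤-trans q≤n n≤f) (≤-trans q≤n n≤g))
    where
    q≤n : suc n / B ≤ n
    q≤n = ≤-pred ([1+n]/B<1+n n)

  s-unfold : ∀ n → s B n ≡ n % B + s B (n / B)
  s-unfold zero = refl
  s-unfold (suc n) = cong (suc n % B +_) (digitSumFuel-enough n (suc n / B) (suc n / B) (≤-pred ([1+n]/B<1+n n)) ≤-refl)

  [r+q*B]/B≡q : ∀ q r → r < B → (r + q * B) / B ≡ q
  [r+q*B]/B≡q q r r<B = begin
    (r + q * B) / B    ≡⟨ +-distrib-/ r (q * B) (subst (_< B) (sym r%B+qB%B≡r) r<B) ⟩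
    r / B + q * B / B  ≡⟨ cong₂ _+_ (m<n⇒m/n≡0 r<B) (m*n/n≡m q B) ⟩
    q                  ∎
    where
    open ≡-Reasoning
    r%B+qB%B≡r : r % B + (q * B) % B ≡ r
    r%B+qB%B≡r = trans (cong₂ _+_ (m<n⇒m%n≡m r<B) (m*n%n≡0 q B)) (+-identityʳ r)

  [r+q*B]%B≡r : ∀ q r → r < B → (r + q * B) % B ≡ r
  [r+q*B]%B≡r q r r<B = trans ([m+kn]%n≡m%n r q B) (m<n⇒m%n≡m r<B)

  s-digit : ∀ q r → r < B → s B (r + q * B) ≡ r + s B q
  s-digit q r r<B =
    trans (s-unfold (r + q * B)) (cong₂ _+_ ([r+q*B]%B≡r q r r<B) (cong (s B) ([r+q*B]/B≡q q r r<B)))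

  n≡n%B+n/B*B : ∀ n → n ≡ n % B + n / B * B
  n≡n%B+n/B*B n = m≡m%n+[m/n]*n n B

  EndsInTop : ℕ → Set
  EndsInTop n = n % B ≡ suc b0

  endsInTop? : ∀ n → Dec (EndsInTop n)
  endsInTop? n = n % B ≟ suc b0

  -- incrementing n turns its J trailing digits suc b0 into 0 and raises the next digit by one
  Carries : ℕ → ℕ → Set
  Carries n J = s B n + 1 ≡ s B (suc n) + suc b0 * J

  s-suc-noCarry : ∀ n → ¬ EndsInTop n → s B (suc n) ≡ suc (s B n)
  s-suc-noCarry n ¬top = begin
    s B (suc n)            ≡⟨ cong (λ z → s B (suc z)) (n≡n%B+n/B*B n) ⟩
    s B (suc r + q * B)    ≡⟨ s-digit q (suc r) 1+r<B ⟩
    suc r + s B q          ≡⟨ cong suc (sym (s-digit q r (m%n<n n B))) ⟩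
    suc (s B (r + q * B))  ≡⟨ cong (λ z → suc (s B z)) (sym (n≡n%B+n/B*B n)) ⟩
    suc (s B n)            ∎
    where
    open ≡-Reasoning
    r = n % B
    q = n / B
    1+r<B : suc r < B
    1+r<B = s≤s (≤∧≢⇒< (≤-pred (m%n<n n B)) ¬top)

  carries-0 : ∀ n → ¬ EndsInTop n → Carries n 0
  carries-0 n ¬top = begin
    s B n + 1               ≡⟨ +-comm (s B n) 1 ⟩
    suc (s B n)             ≡⟨ sym (s-suc-noCarry n ¬top) ⟩
    s B (suc n)             ≡⟨ sym (+-identityʳ _) ⟩
    s B (suc n) + 0         ≡⟨ cong (s B (suc n) +_) (sym (*-zeroʳ (suc b0))) ⟩
    s B (suc n) + suc b0 * 0 ∎
    where open ≡-Reasoning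

  endsInTop⇒≡ : ∀ n → EndsInTop n → n ≡ suc b0 + n / B * B
  endsInTop⇒≡ n top = trans (n≡n%B+n/B*B n) (cong (_+ n / B * B) top)

  carries-suc : ∀ q k → Carries q k → Carries (suc b0 + q * B) (suc k)
  carries-suc q k e = begin
    s B (suc b0 + q * B) + 1                  ≡⟨ cong (_+ 1) (s-digit q (suc b0) ≤-refl) ⟩
    suc b0 + s B q + 1                        ≡⟨ +-assoc (suc b0) (s B q) 1 ⟩
    suc b0 + (s B q + 1)                      ≡⟨ cong (suc b0 +_) e ⟩
    suc b0 + (s B (suc q) + suc b0 * k)       ≡⟨ ring b0 (s B (suc q)) k ⟩
    s B (suc q) + suc b0 * suc k              ≡⟨ cong (_+ suc b0 * suc k) (sym (s-digit (suc q) 0 (s≤s z≤n))) ⟩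
    s B (0 + suc q * B) + suc b0 * suc k      ∎
    where
    open ≡-Reasoning
    ring : ∀ b x k → suc b + (x + suc b * k) ≡ x + suc b * suc k
    ring = solve-∀

  endsInTop⇒nonZero : ∀ n → EndsInTop n → NonZero n
  endsInTop⇒nonZero zero top = ⊥-elim (0≢1+n top)
  endsInTop⇒nonZero (suc n) _ = _

  carries : ∀ n → ∃ (Carries n)
  carries = <-rec (λ n → ∃ (Carries n)) step
    where
    step : ∀ n → (∀ {y} → y < n → ∃ (Carries y)) → ∃ (Carries n)
    step n rec with endsInTop? n
    ... | no ¬top = 0 , carries-0 n ¬top
    ... | yes top =
      let (k , c) = rec (m/n<m n B {{endsInTop⇒nonZero n top}} (s≤s (s≤s z≤n)))
      in suc k , subst (λ z → Carries z (suc k)) (sym (endsInTop⇒≡ n top)) (carries-suc (n / B) k c)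

  ¬endsInTop : ∀ e k → e < suc b0 → ¬ EndsInTop (e + k * B)
  ¬endsInTop e k e< top = <-irrefl (trans (sym ([r+q*B]%B≡r k e (m<n⇒m<1+n e<))) top) e<

  -- n / B and n / B + 1 do not both end in the top digit
  carries-1-here-or-next : ∀ n → EndsInTop n → Carries n 1 ⊎ Carries (n + B) 1
  carries-1-here-or-next n top with endsInTop? (n / B)
  ... | no ¬topq =
    inj₁ (subst (λ z → Carries z 1) (sym (endsInTop⇒≡ n top)) (carries-suc (n / B) 0 (carries-0 (n / B) ¬topq)))
  ... | yes topq =
    inj₂ (subst (λ z → Carries z 1) n+B≡ (carries-suc (suc q) 0 (carries-0 (suc q) ¬top1+q)))
    where
    q = n / B
    ¬top1+q : ¬ EndsInTop (suc q)
    ¬top1+q = subst (λ z → ¬ EndsInTop z) (cong suc (sym (endsInTop⇒≡ q topq))) (¬endsInTop 0 (suc (q / B)) (s≤s z≤n))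
    n+B≡ : suc b0 + suc q * B ≡ n + B
    n+B≡ = begin
      suc b0 + (B + q * B)   ≡⟨ cong (suc b0 +_) (+-comm B (q * B)) ⟩
      suc b0 + (q * B + B)   ≡⟨ sym (+-assoc (suc b0) (q * B) B) ⟩
      suc b0 + q * B + B     ≡⟨ cong (_+ B) (sym (endsInTop⇒≡ n top)) ⟩
      n + B                  ∎
      where open ≡-Reasoning

  endsInTop-gap : ∀ x d → EndsInTop x → EndsInTop (x + d) → 0 < d → d < B + B → d ≡ B
  endsInTop-gap x (suc d) top top' _ d<2B with <-cmp d (suc b0)
  ... | tri≈ _ d≡ _ = cong suc d≡
  ... | tri< d<b _ _ = ⊥-elim (¬endsInTop d (suc q) d<b (subst EndsInTop x+1+d≡ top'))
    where
    q = x / B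
    x+1+d≡ : x + suc d ≡ d + suc q * B
    x+1+d≡ = trans (cong (_+ suc d) (endsInTop⇒≡ x top)) (ring b0 q d)
      where
      ring : ∀ b q d → suc b + q * suc (suc b) + suc d ≡ d + suc q * suc (suc b)
      ring = solve-∀
  ... | tri> _ _ d>b = ⊥-elim (¬endsInTop e (suc (suc q)) e<b (subst EndsInTop x+1+d≡ top'))
    where
    q = x / B
    e = d ∸ B
    B+e≡d : B + e ≡ d
    B+e≡d = m+[n∸m]≡n d>b
    e<b : e < suc b0
    e<b = ≤-pred (+-cancelˡ-≤ B (suc (suc e)) B (subst (_≤ B + B) 2+d≡B+2+e d<2B))
      where
      2+d≡B+2+e : suc (suc d) ≡ B + suc (suc e)
      2+d≡B+2+e = trans (cong (λ z → suc (suc z)) (sym B+e≡d)) (sym (trans (+-suc B (suc e)) (cong suc (+-suc B e))))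
    x+1+d≡ : x + suc d ≡ e + suc (suc q) * B
    x+1+d≡ = trans (cong₂ (λ z w → z + suc w) (endsInTop⇒≡ x top) (sym B+e≡d)) (ring b0 q e)
      where
      ring : ∀ b q e → suc b + q * suc (suc b) + suc (suc (suc b) + e) ≡ e + suc (suc q) * suc (suc b)
      ring = solve-∀

  private
    gap : ∀ {i} x y → EndsInTop (i + x) → EndsInTop (i + y) → x < y → y < x + B + B → y ∸ x ≡ B
    gap {i} x y top-x top-y x<y y< =
      endsInTop-gap (i + x) (y ∸ x) top-x (subst EndsInTop (trans (cong (i +_) (sym x+d≡y)) (sym (+-assoc i x _))) top-y)
        (m<n⇒0<n∸m x<y) (+-cancelˡ-< x (y ∸ x) (B + B) (subst₂ _<_ (sym x+d≡y) (+-assoc x B B) y<))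
      where
      x+d≡y : x + (y ∸ x) ≡ y
      x+d≡y = m+[n∸m]≡n (<⇒≤ x<y)

  endsInTop-near : ∀ i o s → EndsInTop (i + o) → EndsInTop (i + s) → s < o + B + B → o < s + B + B →
                   s ≡ o ⊎ s ≡ o + B ⊎ s + B ≡ o
  endsInTop-near i o s top-o top-s s< o< with <-cmp o s
  ... | tri≈ _ o≡s _ = inj₁ (sym o≡s)
  ... | tri< o<s _ _ = inj₂ (inj₁ (trans (sym (m+[n∸m]≡n (<⇒≤ o<s))) (cong (o +_) (gap {i} o s top-o top-s o<s s<))))
  ... | tri> _ _ s<o = inj₂ (inj₂ (trans (cong (s +_) (sym (gap {i} s o top-s top-o s<o o<))) (m+[n∸m]≡n (<⇒≤ s<o))))

  endsInTop-+B : ∀ x → EndsInTop x → EndsInTop (x + B)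
  endsInTop-+B x top = trans ([m+n]%n≡m%n x B) top

  endsInTop-+B⁻ : ∀ x → EndsInTop (x + B) → EndsInTop x
  endsInTop-+B⁻ x top = trans (sym ([m+n]%n≡m%n x B)) top

  endsInTop-within : ∀ n → ∃ λ k → k < B × EndsInTop (n + k)
  endsInTop-within n = suc b0 ∸ r , s≤s (m∸n≤m (suc b0) r) , trans (cong (_% B) n+k≡) ([r+q*B]%B≡r q (suc b0) ≤-refl)
    where
    r = n % B
    q = n / B
    r≤b : r ≤ suc b0
    r≤b = ≤-pred (m%n<n n B)
    n+k≡ : n + (suc b0 ∸ r) ≡ suc b0 + q * B
    n+k≡ = begin
      n + (suc b0 ∸ r)          ≡⟨ cong (_+ (suc b0 ∸ r)) (n≡n%B+n/B*B n) ⟩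
      r + q * B + (suc b0 ∸ r)  ≡⟨ +-assoc r (q * B) _ ⟩
      r + (q * B + (suc b0 ∸ r)) ≡⟨ cong (r +_) (+-comm (q * B) _) ⟩
      r + ((suc b0 ∸ r) + q * B) ≡⟨ sym (+-assoc r _ (q * B)) ⟩
      r + (suc b0 ∸ r) + q * B  ≡⟨ cong (_+ q * B) (m+[n∸m]≡n r≤b) ⟩
      suc b0 + q * B            ∎
      where open ≡-Reasoning

  -- topDigits k = B ^ k ∸ 1, written with k digits suc b0
  topDigits : ℕ → ℕ
  topDigits zero = 0
  topDigits (suc k) = suc b0 + topDigits k * B

  s-topDigits : ∀ k → s B (topDigits k) ≡ suc b0 * k
  s-topDigits zero = sym (*-zeroʳ (suc b0))
  s-topDigits (suc k) =
    trans (s-digit (topDigits k) (suc b0) ≤-refl) (trans (cong (suc b0 +_) (s-topDigits k)) (sym (*-suc (suc b0) k)))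

  s-suc-topDigits : ∀ k → s B (suc (topDigits k)) ≡ 1
  s-suc-topDigits zero = refl
  s-suc-topDigits (suc k) = trans (s-digit (suc (topDigits k)) 0 (s≤s z≤n)) (s-suc-topDigits k)

  carries-topDigits : ∀ k → Carries (topDigits k) k
  carries-topDigits k = begin
    s B (topDigits k) + 1                   ≡⟨ cong (_+ 1) (s-topDigits k) ⟩
    suc b0 * k + 1                          ≡⟨ +-comm _ 1 ⟩
    1 + suc b0 * k                          ≡⟨ cong (_+ suc b0 * k) (sym (s-suc-topDigits k)) ⟩
    s B (suc (topDigits k)) + suc b0 * k    ∎
    where open ≡-Reasoning

  carries-many-then-1 : ∀ k → ∃ λ n → EndsInTop n × Carries n (suc (suc k)) × Carries (n + B) 1
  carries-many-then-1 k =
    n , [r+q*B]%B≡r q (suc b0) ≤-refl , carries-suc q (suc k) (carries-topDigits (suc k)) ,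
    subst (λ z → Carries z 1) (ring b0 q) (carries-suc (suc q) 0 (carries-0 (suc q) ¬top))
    where
    q = topDigits (suc k)
    n = suc b0 + q * B
    ¬top : ¬ EndsInTop (suc q)
    ¬top = ¬endsInTop 0 (suc (topDigits k)) (s≤s z≤n)
    ring : ∀ b x → suc b + suc x * suc (suc b) ≡ (suc b + x * suc (suc b)) + suc (suc b)
    ring = solve-∀

  carries-1-then-many : ∀ k → ∃ λ n → EndsInTop n × Carries n 1 × Carries (n + B) (suc (suc k))
  carries-1-then-many k =
    n , [r+q*B]%B≡r q (suc b0) ≤-refl , carries-suc q 0 (carries-0 q ¬top) ,
    subst (λ z → Carries z (suc (suc k))) (ring b0 (topDigits k)) (carries-suc (topDigits (suc k)) (suc k) (carries-topDigits (suc k)))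
    where
    q = b0 + topDigits k * B
    n = suc b0 + q * B
    ¬top : ¬ EndsInTop q
    ¬top = ¬endsInTop b0 (topDigits k) ≤-refl
    ring : ∀ b x → suc b + (suc b + x * suc (suc b)) * suc (suc b) ≡ (suc b + (b + x * suc (suc b)) * suc (suc b)) + suc (suc b)
    ring = solve-∀

  s-+high : ∀ P c x → x < B ^ P → s B (x + c * B ^ P) ≡ s B x + s B c
  s-+high zero c zero _ = cong (s B) (*-identityʳ c)
  s-+high zero c (suc x) (s≤s ())
  s-+high (suc P) c x x< = begin
    s B (x + c * B ^ suc P)              ≡⟨ cong (s B) x+c*B^P≡ ⟩
    s B (x % B + (x / B + c * B ^ P) * B) ≡⟨ s-digit (x / B + c * B ^ P) (x % B) (m%n<n x B) ⟩
    x % B + s B (x / B + c * B ^ P)      ≡⟨ cong (x % B +_) (s-+high P c (x / B) (m<n*o⇒m/o<n (subst (x <_) (*-comm B (B ^ P)) x<))) ⟩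
    x % B + (s B (x / B) + s B c)        ≡⟨ sym (+-assoc (x % B) _ _) ⟩
    x % B + s B (x / B) + s B c          ≡⟨ cong (_+ s B c) (sym (s-unfold x)) ⟩
    s B x + s B c                        ∎
    where
    open ≡-Reasoning
    x+c*B^P≡ : x + c * B ^ suc P ≡ x % B + (x / B + c * B ^ P) * B
    x+c*B^P≡ = trans (cong (_+ c * B ^ suc P) (n≡n%B+n/B*B x)) (ring (x % B) (x / B) c (B ^ P) B)
      where
      ring : ∀ r y c p b → r + y * b + c * (b * p) ≡ r + (y + c * p) * b
      ring = solve-∀

  repunit : ℕ → ℕ
  repunit zero = 0
  repunit (suc d) = 1 + repunit d * B

  s-repunit : ∀ d → s B (repunit d) ≡ d
  s-repunit zero = refl
  s-repunit (suc d) = trans (s-digit (repunit d) 1 (s≤s (s≤s z≤n))) (cong suc (s-repunit d))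

  n<B^n : ∀ n → n < B ^ n
  n<B^n zero = s≤s z≤n
  n<B^n (suc n) = ≤-<-trans (n<B^n n) (^-monoʳ-< B (s≤s (s≤s z≤n)) (n<1+n n))

  -- writing the digits of repunit d far to the left of the window [i, i + N) raises every digit sum there by d
  s-raise : ∀ d N i → ∃ λ i' → ∀ k → k < N → s B (i' + k) ≡ d + s B (i + k)
  s-raise d N i = i + repunit d * B ^ (i + N) , λ k k<N → begin
    s B (i + repunit d * B ^ (i + N) + k)    ≡⟨ cong (s B) (ring i (repunit d * B ^ (i + N)) k) ⟩
    s B (i + k + repunit d * B ^ (i + N))    ≡⟨ s-+high (i + N) (repunit d) (i + k) (<-trans (+-monoʳ-< i k<N) (n<B^n (i + N))) ⟩
    s B (i + k) + s B (repunit d)            ≡⟨ cong (s B (i + k) +_) (s-repunit d) ⟩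
    s B (i + k) + d                          ≡⟨ +-comm _ d ⟩
    d + s B (i + k)                          ∎
    where
    open ≡-Reasoning
    ring : ∀ a b c → a + b + c ≡ a + c + b
    ring = solve-∀

-- Congruence modulo M = suc m0

module Congruence (m0 : ℕ) where

  M : ℕ
  M = suc m0

  -- a record rather than x % M ≡ y % M, so that x and y are inferable from a proof
  infix 4 _≈_
  record _≈_ (x y : ℕ) : Set where
    constructor mk≈
    field %≡% : x % M ≡ y % M
  open _≈_ public

  ≈-refl : ∀ {x} → x ≈ x
  ≈-refl = mk≈ refl

  ≈-sym : ∀ {x y} → x ≈ y → y ≈ x
  ≈-sym (mk≈ p) = mk≈ (sym p)

  ≈-trans : ∀ {x y z} → x ≈ y → y ≈ z → x ≈ z
  ≈-trans (mk≈ p) (mk≈ q) = mk≈ (trans p q)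

  ≡⇒≈ : ∀ {x y} → x ≡ y → x ≈ y
  ≡⇒≈ refl = ≈-refl

  ≈-setoid : Setoid _ _
  ≈-setoid = record { Carrier = ℕ ; _≈_ = _≈_ ; isEquivalence = record { refl = ≈-refl ; sym = ≈-sym ; trans = ≈-trans } }

  module ≈-Reasoning = Relation.Binary.Reasoning.Setoid ≈-setoid

  infix 4 _≈?_
  _≈?_ : ∀ x y → Dec (x ≈ y)
  x ≈? y with x % M ≟ y % M
  ... | yes p = yes (mk≈ p)
  ... | no ¬p = no (λ e → ¬p (%≡% e))

  +-cong : ∀ {a b c d} → a ≈ b → c ≈ d → a + c ≈ b + d
  +-cong {a} {b} {c} {d} (mk≈ p) (mk≈ q) =
    mk≈ (trans (%-distribˡ-+ a c M) (trans (cong₂ (λ x y → (x + y) % M) p q) (sym (%-distribˡ-+ b d M))))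

  *-cong : ∀ {a b c d} → a ≈ b → c ≈ d → a * c ≈ b * d
  *-cong {a} {b} {c} {d} (mk≈ p) (mk≈ q) =
    mk≈ (trans (%-distribˡ-* a c M) (trans (cong₂ (λ x y → (x * y) % M) p q) (sym (%-distribˡ-* b d M))))

  m%M≈m : ∀ a → a % M ≈ a
  m%M≈m a = mk≈ (m%n%n≡m%n a M)

  m*M≈0 : ∀ k → k * M ≈ 0
  m*M≈0 k = mk≈ (m*n%n≡0 k M)

  m+M≈m : ∀ a → a + M ≈ a
  m+M≈m a = mk≈ ([m+n]%n≡m%n a M)

  +-cancelʳ-≈ : ∀ {a b} c → a + c ≈ b + c → a ≈ b
  +-cancelʳ-≈ {a} {b} c a+c≈b+c = begin
    a                          ≈⟨ ≈-sym (m+M≈m a) ⟩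
    a + M                      ≡⟨ +M≡ a ⟩
    a + c % M + (M ∸ c % M)    ≈⟨ +-cong (+-cong (≈-refl {a}) (m%M≈m c)) ≈-refl ⟩
    a + c + (M ∸ c % M)        ≈⟨ +-cong a+c≈b+c ≈-refl ⟩
    b + c + (M ∸ c % M)        ≈⟨ +-cong (+-cong (≈-refl {b}) (≈-sym (m%M≈m c))) ≈-refl ⟩
    b + c % M + (M ∸ c % M)    ≡⟨ sym (+M≡ b) ⟩
    b + M                      ≈⟨ m+M≈m b ⟩
    b                          ∎
    where
    open ≈-Reasoning
    +M≡ : ∀ x → x + M ≡ x + c % M + (M ∸ c % M)
    +M≡ x = trans (cong (x +_) (sym (m+[n∸m]≡n (<⇒≤ (m%n<n c M))))) (sym (+-assoc x (c % M) _))

  +-cancelˡ-≈ : ∀ {a b} c → c + a ≈ c + b → a ≈ b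
  +-cancelˡ-≈ {a} {b} c p = +-cancelʳ-≈ c (≈-trans (≡⇒≈ (+-comm a c)) (≈-trans p (≡⇒≈ (+-comm c b))))

  ≈⇒≡ : ∀ {a b} → a < M → b < M → a ≈ b → a ≡ b
  ≈⇒≡ a<M b<M (mk≈ p) = trans (sym (m<n⇒m%n≡m a<M)) (trans p (m<n⇒m%n≡m b<M))

  -- the unique letter z with z + y ≈ x is (x + (M ∸ 1) * y) % M
  ≈-subtract : ∀ x y → ∃ λ z → z < M × z + y ≈ x
  ≈-subtract x y = (x + m0 * y) % M , m%n<n (x + m0 * y) M , (begin
    (x + m0 * y) % M + y  ≈⟨ +-cong (m%M≈m (x + m0 * y)) ≈-refl ⟩
    x + m0 * y + y        ≡⟨ ring x m0 y ⟩
    x + y * M             ≈⟨ +-cong (≈-refl {x}) (m*M≈0 y) ⟩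
    x + 0                 ≡⟨ +-identityʳ x ⟩
    x                     ∎)
    where
    open ≈-Reasoning
    ring : ∀ x m y → x + m * y + y ≡ x + y * suc m
    ring = solve-∀

  B≉1⇒B-1≉0 : ∀ b0 → suc (suc b0) % M ≢ 1 % M → ¬ suc b0 ≈ 0
  B≉1⇒B-1≉0 b0 B≢1 e = B≢1 (%≡% (≈-trans (≡⇒≈ (+-comm 1 (suc b0))) (+-cong e (≈-refl {1}))))

  Ψ-fixed⇒≈ : ∀ x y ys → Ψ M x (y ∷ ys) ≡ y ∷ ys → nth (y ∷ ys) (length ys) < M → x ≈ y + nth (y ∷ ys) (length ys)
  Ψ-fixed⇒≈ x y ys fixed last<M = ≈-sym (begin
    y + z                        ≡⟨ cong (_+ z) y≡ψz ⟩
    (x + (M ∸ z)) % M + z        ≈⟨ +-cong (m%M≈m (x + (M ∸ z))) ≈-refl ⟩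
    x + (M ∸ z) + z              ≡⟨ trans (+-assoc x _ z) (cong (x +_) (m∸n+n≡m (<⇒≤ last<M))) ⟩
    x + M                        ≈⟨ m+M≈m x ⟩
    x                            ∎)
    where
    open ≈-Reasoning
    z = nth (y ∷ ys) (length ys)
    ψ : ℕ → ℕ
    ψ k = (x + (M ∸ k)) % M
    y≡ψz : y ≡ ψ z
    y≡ψz = reverse-map-fixed⇒head≡ ψ y ys fixed

module _ {A : Set} where

  hasCard-⇔ : ∀ {P Q : A → Set} {k} → (∀ a → P a → Q a) → (∀ a → Q a → P a) → HasCard P k → HasCard Q k
  hasCard-⇔ f g (l , u , e , len) = l , u , (λ a → mk⇔ (λ a∈l → f a (to (e a) a∈l)) (λ q → from (e a) (g a q))) , len

  hasCard-0 : ∀ {P : A → Set} → (∀ a → ¬ P a) → HasCard P 0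
  hasCard-0 ¬P = [] , [] , (λ a → mk⇔ (λ ()) (λ p → ⊥-elim (¬P a p))) , refl

  hasCard-1 : ∀ {P : A → Set} x → P x → (∀ a → P a → a ≡ x) → HasCard P 1
  hasCard-1 x px unique = x ∷ [] , [] ∷ [] , (λ a → mk⇔ (λ { (here refl) → px }) (λ p → here (unique a p))) , refl

  hasCard-≡ : ∀ x → HasCard (_≡ x) 1
  hasCard-≡ x = hasCard-1 x refl (λ _ e → e)

  hasCard-⊎ : ∀ {P R : A → Set} {k k'} → (∀ a → P a → R a → ⊥) → HasCard P k → HasCard R k' →
              HasCard (λ a → P a ⊎ R a) (k + k')
  hasCard-⊎ disjoint (l , u , e , len) (l' , u' , e' , len') =
    l ++ l' ,
    Unique.++⁺ u u' (λ { (m , m') → disjoint _ (to (e _) m) (to (e' _) m') }) ,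
    (λ a → mk⇔ (λ m → [ (λ m₁ → inj₁ (to (e a) m₁)) , (λ m₂ → inj₂ (to (e' a) m₂)) ]′ (∈-++⁻ l m))
               (λ { (inj₁ p) → ∈-++⁺ˡ (from (e a) p) ; (inj₂ r) → ∈-++⁺ʳ l (from (e' a) r) })) ,
    trans (length-++ l) (cong₂ _+_ len len')

  hasCard-map : ∀ {C : Set} {P : A → Set} {Q : C → Set} {k} (g : A → C) → (∀ {x y} → g x ≡ g y → x ≡ y)
    → (∀ x → P x → Q (g x)) → (∀ y → Q y → ∃ λ x → P x × y ≡ g x) → HasCard P k → HasCard Q k
  hasCard-map {Q = Q} g g-inj f onto (l , u , e , len) =
    map g l , Unique.map⁺ g-inj u ,
    (λ y → mk⇔ (λ m → let (x , x∈l , y≡) = ∈-map⁻ g m in subst Q (sym y≡) (f x (to (e x) x∈l)))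
               (λ q → let (x , px , y≡) = onto y q in subst (_∈ map g l) (sym y≡) (∈-map⁺ g (from (e x) px)))) ,
    trans (length-map g l) len

  hasCard-×≡ : ∀ {C : Set} {P : A → Set} {k} (c : C) → HasCard P k → HasCard (λ (p : A × C) → P (proj₁ p) × proj₂ p ≡ c) k
  hasCard-×≡ c = hasCard-map (λ a → a , c) (cong proj₁) (λ a pa → pa , refl) (λ { (a , _) (pa , refl) → a , pa , refl })

  hasCard-≡× : ∀ {C : Set} {P : A → Set} {k} (c : C) → HasCard P k → HasCard (λ (p : C × A) → proj₁ p ≡ c × P (proj₂ p)) k
  hasCard-≡× c = hasCard-map (λ a → c , a) (cong proj₂) (λ a pa → refl , pa) (λ { (_ , a) (refl , pa) → a , pa , refl })

  hasCard≥2⇒¬subsingleton : ∀ {P : A → Set} {k} → HasCard P k → 2 ≤ k → ¬ (∀ a a' → P a → P a' → a ≡ a')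
  hasCard≥2⇒¬subsingleton (x ∷ y ∷ l , ((x≢y ∷ _) ∷ _) , e , _) _ subsingleton =
    x≢y (subsingleton x y (to (e x) (here refl)) (to (e y) (there (here refl))))
  hasCard≥2⇒¬subsingleton ([] , _ , _ , refl) ()
  hasCard≥2⇒¬subsingleton (_ ∷ [] , _ , _ , refl) (s≤s ())

hasCard-<-dec : ∀ (P : ℕ → Set) → (∀ a → Dec (P a)) → ∀ n → ∃ λ k → HasCard (λ a → a < n × P a) k
hasCard-<-dec P P? zero = 0 , hasCard-0 (λ a → λ { (() , _) })
hasCard-<-dec P P? (suc n) with hasCard-<-dec P P? n | P? n
... | k , (l , u , e , len) | no ¬pn = k , (l , u , (λ a → mk⇔ (λ m → <-inject (to (e a) m)) (λ q → from (e a) (<-restrict a q))) , len)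
  where
  <-inject : ∀ {a} → a < n × P a → a < suc n × P a
  <-inject (a<n , pa) = m<n⇒m<1+n a<n , pa
  <-restrict : ∀ a → a < suc n × P a → a < n × P a
  <-restrict a (a<1+n , pa) with m<1+n⇒m<n∨m≡n a<1+n
  ... | inj₁ a<n = a<n , pa
  ... | inj₂ refl = ⊥-elim (¬pn pa)
... | k , (l , u , e , len) | yes pn =
  suc k , (n ∷ l , (n∉l l (λ a m → proj₁ (to (e a) m)) ∷ u) ,
  (λ a → mk⇔ (λ { (here refl) → ≤-refl , pn ; (there m) → let (a<n , pa) = to (e a) m in m<n⇒m<1+n a<n , pa })
             (λ { (a< , pa) → ∈n∷l a a< pa })) , cong suc len)
  where
  n∉l : ∀ l' → (∀ a → a ∈ l' → a < n) → All (λ a → ¬ n ≡ a) l'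
  n∉l [] _ = []
  n∉l (x ∷ l') bound = (λ n≡x → <-irrefl (sym n≡x) (bound x (here refl))) ∷ n∉l l' (λ a m → bound a (there m))
  ∈n∷l : ∀ a → a < suc n → P a → a ∈ (n ∷ l)
  ∈n∷l a a<1+n pa with m<1+n⇒m<n∨m≡n a<1+n
  ... | inj₁ a<n = there (from (e a) (a<n , pa))
  ... | inj₂ refl = here refl

module ThueMorse (b0 m0 : ℕ) where

  open DigitSum b0 public
  open Congruence m0 public

  tm : ℕ → ℕ
  tm = t B M

  open Occurrences tm public

  tm≈s : ∀ n → tm n ≈ s B n
  tm≈s n = m%M≈m (s B n)

  tm<M : ∀ n → tm n < M
  tm<M n = m%n<n (s B n) M

  tm-suc : ∀ n → ¬ EndsInTop n → tm n + 1 ≈ tm (suc n)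
  tm-suc n ¬top = begin
    tm n + 1     ≈⟨ +-cong (tm≈s n) ≈-refl ⟩
    s B n + 1    ≡⟨ trans (+-comm (s B n) 1) (sym (s-suc-noCarry n ¬top)) ⟩
    s B (suc n)  ≈⟨ ≈-sym (tm≈s (suc n)) ⟩
    tm (suc n)   ∎
    where open ≈-Reasoning

  StepsByOne : ℕ → Set
  StepsByOne n = s B (suc n) ≈ s B n + 1

  stepsByOne : ∀ n J → Carries n J → suc b0 * J ≈ 0 → StepsByOne n
  stepsByOne n J c [b-1]J≈0 = ≈-sym (begin
    s B n + 1                  ≡⟨ c ⟩
    s B (suc n) + suc b0 * J   ≈⟨ +-cong ≈-refl [b-1]J≈0 ⟩
    s B (suc n) + 0            ≡⟨ +-identityʳ _ ⟩
    s B (suc n)                ∎)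
    where open ≈-Reasoning

  carries-1⇒¬stepsByOne : ¬ suc b0 ≈ 0 → ∀ n → Carries n 1 → ¬ StepsByOne n
  carries-1⇒¬stepsByOne b-1≉0 n carries steps = b-1≉0 (≈-sym (+-cancelˡ-≈ (s B n + 1) (begin
    s B n + 1 + 0             ≡⟨ +-identityʳ _ ⟩
    s B n + 1                 ≡⟨ carries ⟩
    s B (suc n) + suc b0 * 1  ≈⟨ +-cong steps (≡⇒≈ (*-identityʳ (suc b0))) ⟩
    s B n + 1 + suc b0        ∎)))
    where open ≈-Reasoning

  InL⇒occursAt : ∀ l → InL B M l → ∃ λ i → OccursAt i l
  InL⇒occursAt l (i , e) = i , to (factor≡⇔OccursAt i l) e

  occursAt⇒InL : ∀ l i → OccursAt i l → InL B M l
  occursAt⇒InL l i o = i , from (factor≡⇔OccursAt i l) o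

  InL-∷⁻ : ∀ a l → InL B M (a ∷ l) → InL B M l
  InL-∷⁻ a l inl =
    let (i , o) = InL⇒occursAt (a ∷ l) inl in occursAt⇒InL l (suc i) (proj₂ (occursAt-∷⁻ i a l o))

  InL-∷ʳ⁻ : ∀ l c → InL B M (l ++ [ c ]) → InL B M l
  InL-∷ʳ⁻ l c inl =
    let (i , o) = InL⇒occursAt (l ++ [ c ]) inl in occursAt⇒InL l i (proj₁ (occursAt-∷ʳ⁻ i l c o))

  InL⇒nth<M : ∀ w → InL B M w → ∀ j → j < length w → nth w j < M
  InL⇒nth<M w inl j j< = let (i , o) = InL⇒occursAt w inl in subst (_< M) (o j j<) (tm<M (i + j))

  Ascending : List ℕ → Set
  Ascending w = ∀ p → suc p < length w → nth w (suc p) ≈ nth w p + 1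

  ascends-at : ∀ w i p → OccursAt i w → suc p < length w → ¬ EndsInTop (i + p) → nth w (suc p) ≈ nth w p + 1
  ascends-at w i p o p< ¬top = begin
    nth w (suc p)     ≡⟨ sym (o (suc p) p<) ⟩
    tm (i + suc p)    ≡⟨ cong tm (+-suc i p) ⟩
    tm (suc (i + p))  ≈⟨ ≈-sym (tm-suc (i + p) ¬top) ⟩
    tm (i + p) + 1    ≡⟨ cong (_+ 1) (o p (<-trans (n<1+n p) p<)) ⟩
    nth w p + 1       ∎
    where open ≈-Reasoning

  module _ (w : List ℕ) (ℓ : ℕ) (|w|≡ : length w ≡ suc ℓ) (|w|<2B : suc ℓ < B + B) where

    private
      nonAscending⇒leftExt≈ : ∀ p → suc p < length w → ¬ nth w (suc p) ≈ nth w p + 1 → suc p ≢ B →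
                              ∀ a → InL B M (a ∷ w) → a + 1 ≈ nth w 0
      nonAscending⇒leftExt≈ p p< ¬asc p+1≢B a inl with InL⇒occursAt (a ∷ w) inl
      ... | i , o with occursAt-∷⁻ i a w o
      ... | tm-i≡a , o' with endsInTop? i
      ... | no ¬top = begin
        a + 1            ≡⟨ cong (_+ 1) (sym tm-i≡a) ⟩
        tm i + 1         ≈⟨ tm-suc i ¬top ⟩
        tm (suc i)       ≡⟨ cong tm (sym (+-identityʳ (suc i))) ⟩
        tm (suc i + 0)   ≡⟨ o' 0 (<-trans (s≤s z≤n) p<) ⟩
        nth w 0          ∎
        where open ≈-Reasoning
      ... | yes top with endsInTop? (suc i + p)
      ... | no ¬top' = ⊥-elim (¬asc (ascends-at w (suc i) p o' p< ¬top'))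
      ... | yes top' = ⊥-elim (p+1≢B (endsInTop-gap i (suc p) top (subst EndsInTop (sym (+-suc i p)) top')
                                        (s≤s z≤n) (<-trans (subst (suc p <_) |w|≡ p<) |w|<2B)))

      nonAscending⇒rightExt≈ : ∀ p → suc p < length w → ¬ nth w (suc p) ≈ nth w p + 1 → p + B ≢ ℓ →
                               ∀ c → InL B M (w ++ [ c ]) → nth w ℓ + 1 ≈ c
      nonAscending⇒rightExt≈ p p< ¬asc p+B≢ℓ c inl with InL⇒occursAt (w ++ [ c ]) inl
      ... | i , o with occursAt-∷ʳ⁻ i w c o
      ... | o' , tm≡c with endsInTop? (i + ℓ)
      ... | no ¬top = begin
        nth w ℓ + 1        ≡⟨ cong (_+ 1) (sym (o' ℓ (subst (ℓ <_) (sym |w|≡) ≤-refl))) ⟩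
        tm (i + ℓ) + 1     ≈⟨ tm-suc (i + ℓ) ¬top ⟩
        tm (suc (i + ℓ))   ≡⟨ cong tm (trans (sym (+-suc i ℓ)) (cong (i +_) (sym |w|≡))) ⟩
        tm (i + length w)  ≡⟨ tm≡c ⟩
        c                  ∎
        where open ≈-Reasoning
      ... | yes top with endsInTop? (i + p)
      ... | no ¬top' = ⊥-elim (¬asc (ascends-at w i p o' p< ¬top'))
      ... | yes top' = ⊥-elim (p+B≢ℓ (trans (+-comm p B) (trans (cong (_+ p) (sym d≡B)) (m∸n+n≡m (<⇒≤ p<ℓ)))))
        where
        p<ℓ : p < ℓ
        p<ℓ = ≤-pred (subst (suc p <_) |w|≡ p<)
        d≡B : ℓ ∸ p ≡ B
        d≡B = endsInTop-gap (i + p) (ℓ ∸ p) top'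
                (subst EndsInTop (sym (trans (+-assoc i p (ℓ ∸ p)) (cong (i +_) (m+[n∸m]≡n (<⇒≤ p<ℓ))))) top)
                (m<n⇒0<n∸m p<ℓ) (≤-trans (s≤s (m∸n≤m ℓ p)) (<⇒≤ |w|<2B))

    bispecial⇒ascending : Bispecial B M w → Ascending w
    bispecial⇒ascending (_ , (kL , hasCardL , 2≤kL) , (kR , hasCardR , 2≤kR)) p p< with nth w (suc p) ≈? nth w p + 1
    ... | yes asc = asc
    ... | no ¬asc with suc p ≟ B
    ... | no p+1≢B = ⊥-elim (hasCard≥2⇒¬subsingleton hasCardL 2≤kL λ a a' (a<M , la) (a'<M , la') →
            ≈⇒≡ a<M a'<M (+-cancelʳ-≈ 1 (≈-trans (leftExt≈ a la) (≈-sym (leftExt≈ a' la')))))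
      where leftExt≈ = nonAscending⇒leftExt≈ p p< ¬asc p+1≢B
    ... | yes p+1≡B with p + B ≟ ℓ
    ... | no p+B≢ℓ = ⊥-elim (hasCard≥2⇒¬subsingleton hasCardR 2≤kR λ c c' (c<M , rc) (c'<M , rc') →
            ≈⇒≡ c<M c'<M (≈-trans (≈-sym (rightExt≈ c rc)) (rightExt≈ c' rc')))
      where rightExt≈ = nonAscending⇒rightExt≈ p p< ¬asc p+B≢ℓ
    ... | yes p+B≡ℓ = ⊥-elim (<-irrefl (trans (cong suc (sym p+B≡ℓ)) (cong (_+ B) p+1≡B)) |w|<2B)

  s-run : ∀ i ℓ → (∀ j → j < ℓ → StepsByOne (i + j)) → ∀ k → k ≤ ℓ → s B (i + k) ≈ s B i + k
  s-run i ℓ steps zero _ = ≡⇒≈ (trans (cong (s B) (+-identityʳ i)) (sym (+-identityʳ _)))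
  s-run i ℓ steps (suc k) k<ℓ = begin
    s B (i + suc k)      ≡⟨ cong (s B) (+-suc i k) ⟩
    s B (suc (i + k))    ≈⟨ steps k k<ℓ ⟩
    s B (i + k) + 1      ≈⟨ +-cong (s-run i ℓ steps k (<⇒≤ k<ℓ)) ≈-refl ⟩
    s B i + k + 1        ≡⟨ trans (+-assoc (s B i) k 1) (cong (s B i +_) (+-comm k 1)) ⟩
    s B i + suc k        ∎
    where open ≈-Reasoning

-- Two-sided extensions of a run of consecutive letters, and how to realise them

module Run (b0 m0 : ℕ) (w : List ℕ) (ℓ : ℕ) (|w|≡ : length w ≡ suc ℓ)
           (asc : ThueMorse.Ascending b0 m0 w) (w<M : ∀ j → j < suc ℓ → nth w j < Congruence.M m0) where

  open ThueMorse b0 m0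

  L : ℕ
  L = suc ℓ

  w₀ : ℕ
  w₀ = nth w 0

  nth≈w₀+ : ∀ j → j < L → nth w j ≈ w₀ + j
  nth≈w₀+ zero _ = ≡⇒≈ (sym (+-identityʳ w₀))
  nth≈w₀+ (suc j) j< = begin
    nth w (suc j)   ≈⟨ asc j (subst (suc j <_) (sym |w|≡) j<) ⟩
    nth w j + 1     ≈⟨ +-cong (nth≈w₀+ j (<-trans (n<1+n j) j<)) ≈-refl ⟩
    w₀ + j + 1      ≡⟨ trans (+-assoc w₀ j 1) (cong (w₀ +_) (+-comm j 1)) ⟩
    w₀ + suc j      ∎
    where open ≈-Reasoning

  s≈w₀+ : ∀ p → OccursAt p w → ∀ j → j < L → s B (p + j) ≈ w₀ + j
  s≈w₀+ p o j j< = ≈-trans (≈-sym (tm≈s (p + j))) (≈-trans (≡⇒≈ (o j (subst (j <_) (sym |w|≡) j<))) (nth≈w₀+ j j<))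

  stepsByOne-inside : ∀ p → OccursAt p w → ∀ j → j < ℓ → StepsByOne (p + j)
  stepsByOne-inside p o j j< = begin
    s B (suc (p + j))  ≡⟨ cong (s B) (sym (+-suc p j)) ⟩
    s B (p + suc j)    ≈⟨ s≈w₀+ p o (suc j) (s≤s j<) ⟩
    w₀ + suc j         ≡⟨ trans (cong (w₀ +_) (+-comm 1 j)) (sym (+-assoc w₀ j 1)) ⟩
    w₀ + j + 1         ≈⟨ +-cong (≈-sym (s≈w₀+ p o j (<-trans j< (n<1+n ℓ)))) ≈-refl ⟩
    s B (p + j) + 1    ∎
    where open ≈-Reasoning

  -- the letter before, resp. after, an occurrence of w, when J carries happen at that boundary
  LeftLetter : ℕ → ℕ → Set
  LeftLetter J a = a < M × a + 1 ≈ w₀ + suc b0 * J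

  RightLetter : ℕ → ℕ → Set
  RightLetter J c = c < M × w₀ + L ≈ c + suc b0 * J

  leftLetter : ∀ i a J → tm i ≡ a → OccursAt (suc i) w → Carries i J → LeftLetter J a
  leftLetter i a J tm≡a o c = subst (_< M) tm≡a (tm<M i) , (begin
    a + 1                        ≡⟨ cong (_+ 1) (sym tm≡a) ⟩
    tm i + 1                     ≈⟨ +-cong (tm≈s i) ≈-refl ⟩
    s B i + 1                    ≡⟨ c ⟩
    s B (suc i) + suc b0 * J     ≈⟨ +-cong s≈w₀ ≈-refl ⟩
    w₀ + suc b0 * J              ∎)
    where
    open ≈-Reasoning
    s≈w₀ : s B (suc i) ≈ w₀
    s≈w₀ = ≈-trans (≡⇒≈ (cong (s B) (sym (+-identityʳ (suc i)))))
                   (≈-trans (s≈w₀+ (suc i) o 0 (s≤s z≤n)) (≡⇒≈ (+-identityʳ w₀)))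

  rightLetter : ∀ p c J → OccursAt p w → tm (p + L) ≡ c → Carries (p + ℓ) J → RightLetter J c
  rightLetter p c J o tm≡c carries = subst (_< M) tm≡c (tm<M (p + L)) , (begin
    w₀ + L                            ≡⟨ trans (cong (w₀ +_) (+-comm 1 ℓ)) (sym (+-assoc w₀ ℓ 1)) ⟩
    w₀ + ℓ + 1                        ≈⟨ +-cong (≈-sym (s≈w₀+ p o ℓ ≤-refl)) ≈-refl ⟩
    s B (p + ℓ) + 1                   ≡⟨ carries ⟩
    s B (suc (p + ℓ)) + suc b0 * J    ≈⟨ +-cong (≈-sym (tm≈s (suc (p + ℓ)))) ≈-refl ⟩
    tm (suc (p + ℓ)) + suc b0 * J     ≡⟨ cong (λ z → tm z + suc b0 * J) (sym (+-suc p ℓ)) ⟩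
    tm (p + L) + suc b0 * J           ≡⟨ cong (_+ suc b0 * J) tm≡c ⟩
    c + suc b0 * J                    ∎)
    where open ≈-Reasoning

  -- Raising the digit sums of the window [i, i + L + 1] by a suitable d makes it spell a w c.
  realise : ∀ i a c Ja Jc → LeftLetter Ja a → RightLetter Jc c → Carries i Ja → Carries (i + L) Jc →
            (∀ j → j < ℓ → StepsByOne (suc i + j)) → InL B M (a ∷ w ++ [ c ])
  realise i a c Ja Jc (a<M , a+1≈) (c<M , w₀+L≈) carries-a carries-c steps =
    occursAt⇒InL (a ∷ w ++ [ c ]) i' (occursAt-∷⁺ i' a (w ++ [ c ]) tm≡a (occursAt-∷ʳ⁺ (suc i') w c o tm≡c))
    where
    open ≈-Reasoning
    d = proj₁ (≈-subtract w₀ (s B (suc i)))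
    d+s≈w₀ : d + s B (suc i) ≈ w₀
    d+s≈w₀ = proj₂ (proj₂ (≈-subtract w₀ (s B (suc i))))
    i' = proj₁ (s-raise d (suc (suc L)) i)
    raised : ∀ k → k < suc (suc L) → s B (i' + k) ≡ d + s B (i + k)
    raised = proj₂ (s-raise d (suc (suc L)) i)
    inner : ∀ k → k < L → d + s B (i + suc k) ≈ w₀ + k
    inner k k<L = begin
      d + s B (i + suc k)        ≡⟨ cong (λ z → d + s B z) (+-suc i k) ⟩
      d + s B (suc i + k)        ≈⟨ +-cong (≈-refl {d}) (s-run (suc i) ℓ steps k (≤-pred k<L)) ⟩
      d + (s B (suc i) + k)      ≡⟨ sym (+-assoc d _ k) ⟩
      d + s B (suc i) + k        ≈⟨ +-cong d+s≈w₀ ≈-refl ⟩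
      w₀ + k                     ∎
    tm≡a : tm i' ≡ a
    tm≡a = ≈⇒≡ (tm<M i') a<M (≈-trans (tm≈s i') (+-cancelʳ-≈ 1 (begin
      s B i' + 1                    ≡⟨ cong (λ z → s B z + 1) (sym (+-identityʳ i')) ⟩
      s B (i' + 0) + 1              ≡⟨ cong (_+ 1) (trans (raised 0 (s≤s z≤n)) (cong (λ z → d + s B z) (+-identityʳ i))) ⟩
      d + s B i + 1                 ≡⟨ trans (+-assoc d _ 1) (cong (d +_) carries-a) ⟩
      d + (s B (suc i) + suc b0 * Ja) ≡⟨ sym (+-assoc d _ _) ⟩
      d + s B (suc i) + suc b0 * Ja ≈⟨ +-cong d+s≈w₀ ≈-refl ⟩
      w₀ + suc b0 * Ja              ≈⟨ ≈-sym a+1≈ ⟩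
      a + 1                         ∎)))
    o : OccursAt (suc i') w
    o j j< = ≈⇒≡ (tm<M (suc i' + j)) (w<M j j<L) (begin
      tm (suc i' + j)        ≈⟨ tm≈s (suc i' + j) ⟩
      s B (suc i' + j)       ≡⟨ trans (cong (s B) (sym (+-suc i' j))) (raised (suc j) (<-trans (s≤s j<L) (n<1+n (suc L)))) ⟩
      d + s B (i + suc j)    ≈⟨ inner j j<L ⟩
      w₀ + j                 ≈⟨ ≈-sym (nth≈w₀+ j j<L) ⟩
      nth w j                ∎)
      where
      j<L : j < L
      j<L = subst (j <_) |w|≡ j<
    tm≡c : tm (suc i' + length w) ≡ c
    tm≡c = ≈⇒≡ (tm<M (suc i' + length w)) c<M (≈-trans (tm≈s (suc i' + length w)) (+-cancelʳ-≈ (suc b0 * Jc) (begin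
      s B (suc i' + length w) + suc b0 * Jc    ≡⟨ cong (λ z → s B (suc i' + z) + suc b0 * Jc) |w|≡ ⟩
      s B (suc i' + L) + suc b0 * Jc           ≡⟨ cong (_+ suc b0 * Jc) (trans (cong (s B) (sym (+-suc i' L))) (raised (suc L) ≤-refl)) ⟩
      d + s B (i + suc L) + suc b0 * Jc        ≡⟨ trans (+-assoc d _ _) (cong (λ z → d + (s B z + suc b0 * Jc)) (+-suc i L)) ⟩
      d + (s B (suc (i + L)) + suc b0 * Jc)    ≡⟨ cong (d +_) (sym carries-c) ⟩
      d + (s B (i + L) + 1)                    ≡⟨ sym (+-assoc d _ 1) ⟩
      d + s B (i + suc ℓ) + 1                  ≈⟨ +-cong (inner ℓ ≤-refl) ≈-refl ⟩
      w₀ + ℓ + 1                               ≡⟨ trans (+-assoc w₀ ℓ 1) (cong (w₀ +_) (+-comm ℓ 1)) ⟩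
      w₀ + L                                   ≈⟨ w₀+L≈ ⟩
      c + suc b0 * Jc                          ∎)))

  -- Windows starting at n ∸ o where n ends in the top digit: inside the window the only carries are at
  -- offsets o and o + B.
  module Window (n o J₁ J₂ : ℕ) (top : EndsInTop n) (carries₁ : Carries n J₁) (carries₂ : Carries (n + B) J₂)
                (o≤n : o ≤ n) (o<B : o < B) where

    private
      i = n ∸ o

      i+o≡n : i + o ≡ n
      i+o≡n = m∸n+n≡m o≤n

      i+[o+B]≡n+B : i + (o + B) ≡ n + B
      i+[o+B]≡n+B = trans (sym (+-assoc i o B)) (cong (_+ B) i+o≡n)

    carries-window : ∀ s → s < o + B + B →
      (s ≡ o × Carries (i + s) J₁) ⊎ (s ≡ o + B × Carries (i + s) J₂) ⊎ (s ≢ o × s ≢ o + B × Carries (i + s) 0)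
    carries-window s s< with endsInTop? (i + s)
    ... | no ¬top = inj₂ (inj₂ ((λ { refl → ¬top (subst EndsInTop (sym i+o≡n) top) }) ,
                                (λ { refl → ¬top (subst EndsInTop (sym i+[o+B]≡n+B) (endsInTop-+B n top)) }) ,
                                carries-0 (i + s) ¬top))
    ... | yes top-s with endsInTop-near i o s (subst EndsInTop (sym i+o≡n) top) top-s s< o<s+2B
      where
      o<s+2B : o < s + B + B
      o<s+2B = <-≤-trans o<B (≤-trans (m≤m+n B B) (subst (B + B ≤_) (sym (+-assoc s B B)) (m≤n+m (B + B) s)))
    ... | inj₁ refl = inj₁ (refl , subst (λ z → Carries z J₁) (sym i+o≡n) carries₁)
    ... | inj₂ (inj₁ refl) = inj₂ (inj₁ (refl , subst (λ z → Carries z J₂) (sym i+[o+B]≡n+B) carries₂))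
    ... | inj₂ (inj₂ s+B≡o) = ⊥-elim (<-irrefl (sym s+B≡o) (<-≤-trans o<B (m≤n+m B s)))

    realiseAround : ∀ a c Ja Jc → LeftLetter Ja a → RightLetter Jc c →
      (0 ≡ o → Ja ≡ J₁) → (0 ≢ o → Ja ≡ 0) →
      (L ≡ o → Jc ≡ J₁) → (L ≡ o + B → Jc ≡ J₂) → (L ≢ o → L ≢ o + B → Jc ≡ 0) →
      L < o + B + B →
      (∀ s → 0 < s → s < L → (s ≡ o → suc b0 * J₁ ≈ 0) × (s ≡ o + B → suc b0 * J₂ ≈ 0)) →
      InL B M (a ∷ w ++ [ c ])
    realiseAround a c Ja Jc left right Ja-o Ja-¬o Jc-o Jc-o+B Jc-else L< innerCarries =
      realise i a c Ja Jc left right carries-a carries-c steps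
      where
      carries-a : Carries i Ja
      carries-a with carries-window 0 (<-≤-trans (s≤s z≤n) (≤-trans (m≤n+m B o) (m≤m+n (o + B) B)))
      ... | inj₁ (0≡o , cs) = subst₂ Carries (+-identityʳ i) (sym (Ja-o 0≡o)) cs
      ... | inj₂ (inj₁ (0≡o+B , _)) = ⊥-elim (0≢1+n (trans 0≡o+B (+-comm o B)))
      ... | inj₂ (inj₂ (0≢o , _ , cs)) = subst₂ Carries (+-identityʳ i) (sym (Ja-¬o 0≢o)) cs
      carries-c : Carries (i + L) Jc
      carries-c with carries-window L L<
      ... | inj₁ (L≡o , cs) = subst (Carries (i + L)) (sym (Jc-o L≡o)) cs
      ... | inj₂ (inj₁ (L≡o+B , cs)) = subst (Carries (i + L)) (sym (Jc-o+B L≡o+B)) cs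
      ... | inj₂ (inj₂ (L≢o , L≢o+B , cs)) = subst (Carries (i + L)) (sym (Jc-else L≢o L≢o+B)) cs
      steps : ∀ j → j < ℓ → StepsByOne (suc i + j)
      steps j j<ℓ = subst StepsByOne (+-suc i j) steps′
        where
        steps′ : StepsByOne (i + suc j)
        steps′ with carries-window (suc j) (<-trans (s≤s j<ℓ) L<)
        ... | inj₁ (e , cs) = stepsByOne (i + suc j) J₁ cs (proj₁ (innerCarries (suc j) (s≤s z≤n) (s≤s j<ℓ)) e)
        ... | inj₂ (inj₁ (e , cs)) = stepsByOne (i + suc j) J₂ cs (proj₂ (innerCarries (suc j) (s≤s z≤n) (s≤s j<ℓ)) e)
        ... | inj₂ (inj₂ (_ , _ , cs)) = stepsByOne (i + suc j) 0 cs (≡⇒≈ (*-zeroʳ (suc b0)))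

  -- lift J ≡ J + 2 M, in the form suc (suc k) produced by carries-many-then-1 and carries-1-then-many
  lift : ℕ → ℕ
  lift J = suc (suc (J + (m0 + m0)))

  *-lift : ∀ J → suc b0 * lift J ≈ suc b0 * J
  *-lift J = begin
    suc b0 * lift J                          ≡⟨ ring b0 J m0 ⟩
    suc b0 * J + (suc b0 + suc b0) * M       ≈⟨ +-cong (≈-refl {suc b0 * J}) (m*M≈0 (suc b0 + suc b0)) ⟩
    suc b0 * J + 0                           ≡⟨ +-identityʳ _ ⟩
    suc b0 * J                               ∎
    where
    open ≈-Reasoning
    ring : ∀ b J m → suc b * suc (suc (J + (m + m))) ≡ suc b * J + (suc b + suc b) * suc m
    ring = solve-∀

  *-lift0 : suc b0 * lift 0 ≈ 0
  *-lift0 = ≈-trans (*-lift 0) (≡⇒≈ (*-zeroʳ (suc b0)))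

  leftLetter-lift : ∀ {J a} → LeftLetter J a → LeftLetter (lift J) a
  leftLetter-lift (a<M , e) = a<M , ≈-trans e (+-cong (≈-refl {w₀}) (≈-sym (*-lift _)))

  rightLetter-lift : ∀ {J c} → RightLetter J c → RightLetter (lift J) c
  rightLetter-lift {c = c} (c<M , e) = c<M , ≈-trans e (+-cong (≈-refl {c}) (≈-sym (*-lift _)))

  endsInTop⇒b-1≤ : ∀ n → EndsInTop n → suc b0 ≤ n
  endsInTop⇒b-1≤ n top = subst (suc b0 ≤_) (sym (endsInTop⇒≡ n top)) (m≤m+n (suc b0) _)

  realise-J-0 : L < B → ∀ J a c → LeftLetter J a → RightLetter 0 c → InL B M (a ∷ w ++ [ c ])
  realise-J-0 L<B J a c left right with carries-many-then-1 (J + (m0 + m0))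
  ... | n , top , c₁ , c₂ = Window.realiseAround n 0 (lift J) 1 top c₁ c₂ z≤n (s≤s z≤n) a c (lift J) 0
    (leftLetter-lift left) right (λ _ → refl) (λ 0≢0 → ⊥-elim (0≢0 refl))
    (λ ()) (λ L≡B → ⊥-elim (<-irrefl L≡B L<B)) (λ _ _ → refl)
    (<-≤-trans L<B (m≤m+n B B))
    (λ s 0<s s<L → (λ { refl → ⊥-elim (<-irrefl refl 0<s) }) , (λ { refl → ⊥-elim (<-asym s<L L<B) }))

  realise-0-J : L < B → ∀ J a c → LeftLetter 0 a → RightLetter J c → InL B M (a ∷ w ++ [ c ])
  realise-0-J L<B J a c left right with carries-many-then-1 (J + (m0 + m0))
  ... | n , top , c₁ , c₂ = Window.realiseAround n L (lift J) 1 top c₁ c₂ (≤-trans (≤-pred L<B) (endsInTop⇒b-1≤ n top)) L<B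
    a c 0 (lift J) left (rightLetter-lift right) (λ ()) (λ _ → refl)
    (λ _ → refl) (λ L≡L+B → ⊥-elim (<-irrefl L≡L+B (m<m+n L (s≤s z≤n)))) (λ L≢L _ → ⊥-elim (L≢L refl))
    (<-≤-trans (m<m+n L (s≤s z≤n)) (m≤m+n (L + B) B))
    (λ s 0<s s<L → (λ { refl → ⊥-elim (<-irrefl refl s<L) }) , (λ { refl → ⊥-elim (<-asym s<L (m<m+n L (s≤s z≤n))) }))

  B<B+B : B < B + B
  B<B+B = m<m+n B (s≤s z≤n)

  realise-J-1 : L ≡ B → ∀ J a c → LeftLetter J a → RightLetter 1 c → InL B M (a ∷ w ++ [ c ])
  realise-J-1 L≡B J a c left right with carries-many-then-1 (J + (m0 + m0))
  ... | n , top , c₁ , c₂ = Window.realiseAround n 0 (lift J) 1 top c₁ c₂ z≤n (s≤s z≤n) a c (lift J) 1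
    (leftLetter-lift left) right (λ _ → refl) (λ 0≢0 → ⊥-elim (0≢0 refl))
    (λ ()) (λ _ → refl) (λ _ L≢B → ⊥-elim (L≢B L≡B))
    (subst (_< B + B) (sym L≡B) B<B+B)
    (λ s 0<s s<L → (λ { refl → ⊥-elim (<-irrefl refl 0<s) }) , (λ { refl → ⊥-elim (<-irrefl (sym L≡B) s<L) }))

  realise-1-J : L ≡ B → ∀ J a c → LeftLetter 1 a → RightLetter J c → InL B M (a ∷ w ++ [ c ])
  realise-1-J L≡B J a c left right with carries-1-then-many (J + (m0 + m0))
  ... | n , top , c₁ , c₂ = Window.realiseAround n 0 1 (lift J) top c₁ c₂ z≤n (s≤s z≤n) a c 1 (lift J)
    left (rightLetter-lift right) (λ _ → refl) (λ 0≢0 → ⊥-elim (0≢0 refl))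
    (λ ()) (λ _ → refl) (λ _ L≢B → ⊥-elim (L≢B L≡B))
    (subst (_< B + B) (sym L≡B) B<B+B)
    (λ s 0<s s<L → (λ { refl → ⊥-elim (<-irrefl refl 0<s) }) , (λ { refl → ⊥-elim (<-irrefl (sym L≡B) s<L) }))

  -- the one carry strictly inside the window, at offset suc b0, consists of lift 0 ≡ 2M carries and so changes no letter
  realise-0-0 : B ≤ L → L ≤ suc b0 + suc b0 → ∀ a c → LeftLetter 0 a → RightLetter 0 c → InL B M (a ∷ w ++ [ c ])
  realise-0-0 B≤L L≤ a c left right with carries-many-then-1 (0 + (m0 + m0))
  ... | n , top , c₁ , c₂ = Window.realiseAround n (suc b0) (lift 0) 1 top c₁ c₂ (endsInTop⇒b-1≤ n top) ≤-refl a c 0 0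
    left right (λ ()) (λ _ → refl)
    (λ L≡b-1 → ⊥-elim (<-irrefl (sym L≡b-1) B≤L)) (λ L≡ → ⊥-elim (<-irrefl L≡ L<)) (λ _ _ → refl)
    (<-≤-trans L< (m≤m+n (suc b0 + B) B))
    (λ s 0<s s<L → (λ _ → *-lift0) , (λ { refl → ⊥-elim (<-asym s<L L<) }))
    where
    L< : L < suc b0 + B
    L< = ≤-<-trans L≤ (+-monoʳ-< (suc b0) (n<1+n (suc b0)))

  realise-1-0 : B < L → L < B + B → ∀ a c → LeftLetter 1 a → RightLetter 0 c → InL B M (a ∷ w ++ [ c ])
  realise-1-0 B<L L<2B a c left right with carries-1-then-many (0 + (m0 + m0))
  ... | n , top , c₁ , c₂ = Window.realiseAround n 0 1 (lift 0) top c₁ c₂ z≤n (s≤s z≤n) a c 1 0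
    left right (λ _ → refl) (λ 0≢0 → ⊥-elim (0≢0 refl))
    (λ ()) (λ L≡B → ⊥-elim (<-irrefl (sym L≡B) B<L)) (λ _ _ → refl)
    L<2B
    (λ s 0<s s<L → (λ { refl → ⊥-elim (<-irrefl refl 0<s) }) , (λ _ → *-lift0))

  realise-0-1 : B < L → L < B + B → ∀ a c → LeftLetter 0 a → RightLetter 1 c → InL B M (a ∷ w ++ [ c ])
  realise-0-1 B<L L<2B a c left right with carries-many-then-1 (0 + (m0 + m0))
  ... | n , top , c₁ , c₂ = Window.realiseAround n o (lift 0) 1 top c₁ c₂ (≤-trans (≤-pred o<B) (endsInTop⇒b-1≤ n top)) o<B a c 0 1
    left right (λ 0≡o → ⊥-elim (<-irrefl (sym (trans (sym o+B≡L) (cong (_+ B) (sym 0≡o)))) B<L)) (λ _ → refl)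
    (λ L≡o → ⊥-elim (<-irrefl (sym L≡o) (subst (o <_) o+B≡L (m<m+n o (s≤s z≤n))))) (λ _ → refl)
    (λ _ L≢o+B → ⊥-elim (L≢o+B (sym o+B≡L)))
    (subst (_< o + B + B) o+B≡L (m<m+n (o + B) (s≤s z≤n)))
    (λ s 0<s s<L → (λ _ → *-lift0) , (λ { refl → ⊥-elim (<-irrefl o+B≡L s<L) }))
    where
    o = L ∸ B
    o+B≡L : o + B ≡ L
    o+B≡L = m∸n+n≡m (<⇒≤ B<L)
    o<B : o < B
    o<B = +-cancelʳ-< B o B (subst (_< B + B) (sym o+B≡L) L<2B)

  IsLeftLetter : ℕ → Set
  IsLeftLetter a = ∃ λ J → LeftLetter J a

  IsRightLetter : ℕ → Set
  IsRightLetter c = ∃ λ J → RightLetter J c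

  lext⇒occursAt : ∀ a → InL B M (a ∷ w) → ∃ λ i → tm i ≡ a × OccursAt (suc i) w
  lext⇒occursAt a inl = let (i , o) = InL⇒occursAt (a ∷ w) inl in i , occursAt-∷⁻ i a w o

  rext⇒occursAt : ∀ c → InL B M (w ++ [ c ]) → ∃ λ p → OccursAt p w × tm (p + L) ≡ c
  rext⇒occursAt c inl with InL⇒occursAt (w ++ [ c ]) inl
  ... | p , o with occursAt-∷ʳ⁻ p w c o
  ... | o' , tm≡c = p , o' , subst (λ z → tm (p + z) ≡ c) |w|≡ tm≡c

  bext⇒occursAt : ∀ a c → InL B M (a ∷ w ++ [ c ]) → ∃ λ i → tm i ≡ a × OccursAt (suc i) w × tm (suc i + L) ≡ c
  bext⇒occursAt a c inl with InL⇒occursAt (a ∷ w ++ [ c ]) inl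
  ... | i , o with occursAt-∷⁻ i a (w ++ [ c ]) o
  ... | tm≡a , o' with occursAt-∷ʳ⁻ (suc i) w c o'
  ... | o'' , tm≡c = i , tm≡a , o'' , subst (λ z → tm (suc i + z) ≡ c) |w|≡ tm≡c

  rightLetter′ : ∀ i c J → OccursAt (suc i) w → tm (suc i + L) ≡ c → Carries (i + L) J → RightLetter J c
  rightLetter′ i c J o tm≡c carries = rightLetter (suc i) c J o tm≡c (subst (λ z → Carries z J) (+-suc i ℓ) carries)

  stepsByOne-inner : ∀ i → OccursAt (suc i) w → ∀ s → 0 < s → s ≤ ℓ → StepsByOne (i + s)
  stepsByOne-inner i o (suc s) _ s≤ℓ = subst StepsByOne (sym (+-suc i s)) (stepsByOne-inside (suc i) o s s≤ℓ)

  lext⇒isLeftLetter : ∀ a → InL B M (a ∷ w) → IsLeftLetter a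
  lext⇒isLeftLetter a inl with lext⇒occursAt a inl
  ... | i , tm≡a , o = let (J , cs) = carries i in J , leftLetter i a J tm≡a o cs

  rext⇒isRightLetter : ∀ c → InL B M (w ++ [ c ]) → IsRightLetter c
  rext⇒isRightLetter c inl with rext⇒occursAt c inl
  ... | p , o , tm≡c = let (J , cs) = carries (p + ℓ) in J , rightLetter p c J o tm≡c cs

  -- both ends of a short occurrence cannot end in the top digit
  bext-short : L < B → ∀ a c → InL B M (a ∷ w ++ [ c ]) → (IsLeftLetter a × RightLetter 0 c) ⊎ (LeftLetter 0 a × IsRightLetter c)
  bext-short L<B a c inl with bext⇒occursAt a c inl
  ... | i , tm≡a , o , tm≡c with endsInTop? i
  ... | no ¬top = inj₂ (leftLetter i a 0 tm≡a o (carries-0 i ¬top) ,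
                        let (J , cs) = carries (i + L) in J , rightLetter′ i c J o tm≡c cs)
  ... | yes top with endsInTop? (i + L)
  ... | yes top' = ⊥-elim (<-irrefl (endsInTop-gap i L top top' (s≤s z≤n) (<-≤-trans L<B (m≤m+n B B))) L<B)
  ... | no ¬top' = inj₁ ((let (J , cs) = carries i in J , leftLetter i a J tm≡a o cs) ,
                         rightLetter′ i c 0 o tm≡c (carries-0 (i + L) ¬top'))

  bext-B : L ≡ B → ∀ a c → InL B M (a ∷ w ++ [ c ]) →
           (IsLeftLetter a × RightLetter 1 c) ⊎ (LeftLetter 1 a × IsRightLetter c) ⊎ (LeftLetter 0 a × RightLetter 0 c)
  bext-B L≡B a c inl with bext⇒occursAt a c inl
  ... | i , tm≡a , o , tm≡c with endsInTop? i
  ... | no ¬top = inj₂ (inj₂ (leftLetter i a 0 tm≡a o (carries-0 i ¬top) , rightLetter′ i c 0 o tm≡c (carries-0 (i + L) ¬top')))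
    where
    ¬top' : ¬ EndsInTop (i + L)
    ¬top' top' = ¬top (endsInTop-+B⁻ i (subst (λ z → EndsInTop (i + z)) L≡B top'))
  ... | yes top with carries-1-here-or-next i top
  ... | inj₁ cs = inj₂ (inj₁ (leftLetter i a 1 tm≡a o cs , let (J , cs') = carries (i + L) in J , rightLetter′ i c J o tm≡c cs'))
  ... | inj₂ cs = inj₁ ((let (J , cs') = carries i in J , leftLetter i a J tm≡a o cs') ,
                        rightLetter′ i c 1 o tm≡c (subst (λ z → Carries (i + z) 1) (sym L≡B) cs))

  module Long (b-1≉0 : ¬ suc b0 ≈ 0) (B<L : B < L) (L<2B : L < B + B) where

    B≤ℓ : B ≤ ℓ
    B≤ℓ = ≤-pred B<L

    -- a single carry is visible modulo M, so it cannot occur strictly inside an occurrence of w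
    lext-long : ∀ a → InL B M (a ∷ w) → LeftLetter 1 a ⊎ LeftLetter 0 a
    lext-long a inl with lext⇒occursAt a inl
    ... | i , tm≡a , o with endsInTop? i
    ... | no ¬top = inj₂ (leftLetter i a 0 tm≡a o (carries-0 i ¬top))
    ... | yes top with carries-1-here-or-next i top
    ... | inj₁ cs = inj₁ (leftLetter i a 1 tm≡a o cs)
    ... | inj₂ cs = ⊥-elim (carries-1⇒¬stepsByOne b-1≉0 (i + B) cs (stepsByOne-inner i o B (s≤s z≤n) B≤ℓ))

    p+[ℓ∸B]+B≡p+ℓ : ∀ p → p + (ℓ ∸ B) + B ≡ p + ℓ
    p+[ℓ∸B]+B≡p+ℓ p = trans (+-assoc p _ B) (cong (p +_) (m∸n+n≡m B≤ℓ))

    rightLetter-top : ∀ p c → OccursAt p w → tm (p + L) ≡ c → EndsInTop (p + ℓ) → RightLetter 1 c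
    rightLetter-top p c o tm≡c top
      with carries-1-here-or-next (p + (ℓ ∸ B)) (endsInTop-+B⁻ (p + (ℓ ∸ B)) (subst EndsInTop (sym (p+[ℓ∸B]+B≡p+ℓ p)) top))
    ... | inj₁ cs = ⊥-elim (carries-1⇒¬stepsByOne b-1≉0 (p + (ℓ ∸ B)) cs
                             (stepsByOne-inside p o (ℓ ∸ B) (∸-monoʳ-< {ℓ} {B} {0} (s≤s z≤n) B≤ℓ)))
    ... | inj₂ cs = rightLetter p c 1 o tm≡c (subst (λ z → Carries z 1) (p+[ℓ∸B]+B≡p+ℓ p) cs)

    rightLetter-long : ∀ p c → OccursAt p w → tm (p + L) ≡ c → RightLetter 1 c ⊎ RightLetter 0 c
    rightLetter-long p c o tm≡c with endsInTop? (p + ℓ)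
    ... | no ¬top = inj₂ (rightLetter p c 0 o tm≡c (carries-0 (p + ℓ) ¬top))
    ... | yes top = inj₁ (rightLetter-top p c o tm≡c top)

    rext-long : ∀ c → InL B M (w ++ [ c ]) → RightLetter 1 c ⊎ RightLetter 0 c
    rext-long c inl = let (p , o , tm≡c) = rext⇒occursAt c inl in rightLetter-long p c o tm≡c

    bext-long-top : ∀ a c i → tm i ≡ a → OccursAt (suc i) w → tm (suc i + L) ≡ c → EndsInTop i → LeftLetter 1 a × RightLetter 0 c
    bext-long-top a c i tm≡a o tm≡c top = left , right
      where
      left : LeftLetter 1 a
      left with carries-1-here-or-next i top
      ... | inj₁ cs = leftLetter i a 1 tm≡a o cs
      ... | inj₂ cs = ⊥-elim (carries-1⇒¬stepsByOne b-1≉0 (i + B) cs (stepsByOne-inner i o B (s≤s z≤n) B≤ℓ))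
      right : RightLetter 0 c
      right with endsInTop? (i + L)
      ... | yes top' = ⊥-elim (<-irrefl (sym (endsInTop-gap i L top top' (s≤s z≤n) L<2B)) B<L)
      ... | no ¬top' = rightLetter′ i c 0 o tm≡c (carries-0 (i + L) ¬top')

    bext-long : ∀ a c → InL B M (a ∷ w ++ [ c ]) →
                (LeftLetter 1 a × RightLetter 0 c) ⊎ (LeftLetter 0 a × RightLetter 1 c) ⊎ (LeftLetter 0 a × RightLetter 0 c)
    bext-long a c inl with bext⇒occursAt a c inl
    ... | i , tm≡a , o , tm≡c with endsInTop? i
    ... | yes top = inj₁ (bext-long-top a c i tm≡a o tm≡c top)
    ... | no ¬top with rightLetter-long (suc i) c o tm≡c
    ... | inj₁ right = inj₂ (inj₁ (leftLetter i a 0 tm≡a o (carries-0 i ¬top) , right))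
    ... | inj₂ right = inj₂ (inj₂ (leftLetter i a 0 tm≡a o (carries-0 i ¬top) , right))

    -- otherwise some position ending in the top digit, and with it a single carry, lies strictly inside the occurrence
    ¬endsInTop-both-ends : L ≡ suc b0 + B → ∀ i → OccursAt (suc i) w → ¬ EndsInTop i → ¬ EndsInTop (i + L) → ⊥
    ¬endsInTop-both-ends L≡ i o ¬top ¬top' with endsInTop-within i
    ... | zero , _ , top = ¬top (subst EndsInTop (+-identityʳ i) top)
    ... | suc k , k<B , top with k ≟ b0
    ... | yes refl = ¬top' (subst EndsInTop (trans (+-assoc i (suc b0) B) (cong (i +_) (sym L≡))) (endsInTop-+B (i + suc b0) top))
    ... | no k≢b0 = [ (λ cs → carries-1⇒¬stepsByOne b-1≉0 (i + suc k) cs (stepsByOne-inner i o (suc k) (s≤s z≤n) 1+k≤ℓ)) ,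
                      (λ cs → carries-1⇒¬stepsByOne b-1≉0 (i + suc k + B) cs
                                (subst StepsByOne (sym (+-assoc i (suc k) B)) (stepsByOne-inner i o (suc k + B) (s≤s z≤n) 1+k+B≤ℓ))) ]′
                    (carries-1-here-or-next (i + suc k) top)
      where
      ℓ≡ : ℓ ≡ b0 + B
      ℓ≡ = suc-injective L≡
      k<b0 : k < b0
      k<b0 = ≤∧≢⇒< (≤-pred (≤-pred k<B)) k≢b0
      1+k≤ℓ : suc k ≤ ℓ
      1+k≤ℓ = subst (suc k ≤_) (sym ℓ≡) (≤-trans k<b0 (m≤m+n b0 B))
      1+k+B≤ℓ : suc k + B ≤ ℓ
      1+k+B≤ℓ = subst (suc k + B ≤_) (sym ℓ≡) (+-monoˡ-≤ B k<b0)

    bext-2B-1 : L ≡ suc b0 + B → ∀ a c → InL B M (a ∷ w ++ [ c ]) →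
                (LeftLetter 1 a × RightLetter 0 c) ⊎ (LeftLetter 0 a × RightLetter 1 c)
    bext-2B-1 L≡ a c inl with bext⇒occursAt a c inl
    ... | i , tm≡a , o , tm≡c with endsInTop? i
    ... | yes top = inj₁ (bext-long-top a c i tm≡a o tm≡c top)
    ... | no ¬top with endsInTop? (i + L)
    ... | no ¬top' = ⊥-elim (¬endsInTop-both-ends L≡ i o ¬top ¬top')
    ... | yes top' = inj₂ (leftLetter i a 0 tm≡a o (carries-0 i ¬top) ,
                           rightLetter-top (suc i) c o tm≡c (subst EndsInTop (+-suc i ℓ) top'))

-- Counting the extensions of a run

module Counting (b0 m0 : ℕ) (w : List ℕ) (ℓ : ℕ) (|w|≡ : length w ≡ suc ℓ)
                (asc : ThueMorse.Ascending b0 m0 w) (w<M : ∀ j → j < suc ℓ → nth w j < Congruence.M m0)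
                (b-1≉0 : ¬ Congruence._≈_ m0 (suc b0) 0)
                (x : ℕ) (x≈ : Congruence._≈_ m0 x (nth w 0 + nth w ℓ)) where

  open ThueMorse b0 m0
  open Run b0 m0 w ℓ |w|≡ asc w<M

  leftLetter-unique : ∀ {J a a'} → LeftLetter J a → LeftLetter J a' → a ≡ a'
  leftLetter-unique (a<M , e) (a'<M , e') = ≈⇒≡ a<M a'<M (+-cancelʳ-≈ 1 (≈-trans e (≈-sym e')))

  rightLetter-unique : ∀ {J c c'} → RightLetter J c → RightLetter J c' → c ≡ c'
  rightLetter-unique {J} (c<M , e) (c'<M , e') = ≈⇒≡ c<M c'<M (+-cancelʳ-≈ (suc b0 * J) (≈-trans (≈-sym e) e'))

  leftLetter-exists : ∀ J → ∃ (LeftLetter J)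
  leftLetter-exists J = ≈-subtract (w₀ + suc b0 * J) 1

  rightLetter-exists : ∀ J → ∃ (RightLetter J)
  rightLetter-exists J = let (z , z<M , e) = ≈-subtract (w₀ + L) (suc b0 * J) in z , z<M , ≈-sym e

  +[b-1]*0≉+[b-1]*1 : ∀ {K} → ¬ K + suc b0 * 0 ≈ K + suc b0 * 1
  +[b-1]*0≉+[b-1]*1 {K} e =
    b-1≉0 (≈-sym (≈-trans (≡⇒≈ (sym (*-zeroʳ (suc b0)))) (≈-trans (+-cancelˡ-≈ K e) (≡⇒≈ (*-identityʳ (suc b0))))))

  ¬leftLetter-0-1 : ∀ {a} → LeftLetter 0 a → ¬ LeftLetter 1 a
  ¬leftLetter-0-1 (_ , e) (_ , e') = +[b-1]*0≉+[b-1]*1 (≈-trans (≈-sym e) e')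

  ¬rightLetter-0-1 : ∀ {c} → RightLetter 0 c → ¬ RightLetter 1 c
  ¬rightLetter-0-1 {c} (_ , e) (_ , e') = +[b-1]*0≉+[b-1]*1 {c} (≈-trans (≈-sym e) e')

  a₀ a₁ c₀ c₁ : ℕ
  a₀ = proj₁ (leftLetter-exists 0)
  a₁ = proj₁ (leftLetter-exists 1)
  c₀ = proj₁ (rightLetter-exists 0)
  c₁ = proj₁ (rightLetter-exists 1)

  left₀ : LeftLetter 0 a₀
  left₀ = proj₂ (leftLetter-exists 0)

  left₁ : LeftLetter 1 a₁
  left₁ = proj₂ (leftLetter-exists 1)

  right₀ : RightLetter 0 c₀
  right₀ = proj₂ (rightLetter-exists 0)

  right₁ : RightLetter 1 c₁
  right₁ = proj₂ (rightLetter-exists 1)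

  a₁≢a₀ : a₁ ≢ a₀
  a₁≢a₀ e = ¬leftLetter-0-1 (subst (LeftLetter 0) (sym e) left₀) left₁

  c₁≢c₀ : c₁ ≢ c₀
  c₁≢c₀ e = ¬rightLetter-0-1 (subst (RightLetter 0) (sym e) right₀) right₁

  ψ : ℕ → ℕ
  ψ a = (x + (M ∸ a)) % M

  ψ<M : ∀ a → ψ a < M
  ψ<M a = m%n<n (x + (M ∸ a)) M

  ψa+a≈x : ∀ a → a < M → ψ a + a ≈ x
  ψa+a≈x a a<M = begin
    ψ a + a               ≈⟨ +-cong (m%M≈m (x + (M ∸ a))) ≈-refl ⟩
    x + (M ∸ a) + a       ≡⟨ trans (+-assoc x _ a) (cong (x +_) (m∸n+n≡m (<⇒≤ a<M))) ⟩
    x + M                 ≈⟨ m+M≈m x ⟩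
    x                     ∎
    where open ≈-Reasoning

  x≈w₀+w₀+ℓ : x ≈ w₀ + (w₀ + ℓ)
  x≈w₀+w₀+ℓ = ≈-trans x≈ (+-cong (≈-refl {w₀}) (nth≈w₀+ ℓ ≤-refl))

  -- a w ψ(a) extends w exactly when a and ψ(a) correspond to the same number of carries, because ψ(a) + a ≈ w₀ + (w₀ + ℓ)
  left⇒right-ψ : ∀ {J a} → LeftLetter J a → RightLetter J (ψ a)
  left⇒right-ψ {J} {a} (a<M , e) = ψ<M a , +-cancelʳ-≈ (a + 1) (begin
    w₀ + L + (a + 1)                   ≈⟨ +-cong (≈-refl {w₀ + L}) e ⟩
    w₀ + L + (w₀ + K)                  ≡⟨ ring w₀ ℓ K ⟩
    w₀ + (w₀ + ℓ) + (K + 1)            ≈⟨ +-cong (≈-sym x≈w₀+w₀+ℓ) ≈-refl ⟩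
    x + (K + 1)                        ≈⟨ +-cong (≈-sym (ψa+a≈x a a<M)) ≈-refl ⟩
    ψ a + a + (K + 1)                  ≡⟨ ring′ (ψ a) a K ⟩
    ψ a + K + (a + 1)                  ∎)
    where
    open ≈-Reasoning
    K = suc b0 * J
    ring : ∀ w l K → w + suc l + (w + K) ≡ w + (w + l) + (K + 1)
    ring = solve-∀
    ring′ : ∀ c a K → c + a + (K + 1) ≡ c + K + (a + 1)
    ring′ = solve-∀

  right-ψ⇒left : ∀ {J a} → a < M → RightLetter J (ψ a) → LeftLetter J a
  right-ψ⇒left {J} {a} a<M (_ , e) = a<M , +-cancelʳ-≈ (w₀ + L) (begin
    a + 1 + (w₀ + L)                   ≈⟨ +-cong (≈-refl {a + 1}) e ⟩
    a + 1 + (ψ a + K)                  ≡⟨ ring′ (ψ a) a K ⟩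
    ψ a + a + (K + 1)                  ≈⟨ +-cong (ψa+a≈x a a<M) ≈-refl ⟩
    x + (K + 1)                        ≈⟨ +-cong x≈w₀+w₀+ℓ ≈-refl ⟩
    w₀ + (w₀ + ℓ) + (K + 1)            ≡⟨ ring w₀ ℓ K ⟩
    w₀ + K + (w₀ + L)                  ∎)
    where
    open ≈-Reasoning
    K = suc b0 * J
    ring : ∀ w l K → w + (w + l) + (K + 1) ≡ w + K + (w + suc l)
    ring = solve-∀
    ring′ : ∀ c a K → a + 1 + (c + K) ≡ c + a + (K + 1)
    ring′ = solve-∀

  -- the number of carries only matters modulo M, which makes "is a left/right letter" decidable
  IsLeftLetterFin : ℕ → Set
  IsLeftLetterFin a = ∃ λ (j : Fin M) → a + 1 ≈ w₀ + suc b0 * toℕ j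

  IsRightLetterFin : ℕ → Set
  IsRightLetterFin c = ∃ λ (j : Fin M) → w₀ + L ≈ c + suc b0 * toℕ j

  isLeftLetterFin? : ∀ a → Dec (IsLeftLetterFin a)
  isLeftLetterFin? a = any? (λ j → a + 1 ≈? w₀ + suc b0 * toℕ j)

  isRightLetterFin? : ∀ c → Dec (IsRightLetterFin c)
  isRightLetterFin? c = any? (λ j → w₀ + L ≈? c + suc b0 * toℕ j)

  *-reduce : ∀ J → suc b0 * J ≈ suc b0 * toℕ (fromℕ< (m%n<n J M))
  *-reduce J = *-cong (≈-refl {suc b0}) (≈-sym (≈-trans (≡⇒≈ (toℕ-fromℕ< (m%n<n J M))) (m%M≈m J)))

  isLeftLetter⇒Fin : ∀ {a} → IsLeftLetter a → a < M × IsLeftLetterFin a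
  isLeftLetter⇒Fin (J , a<M , e) = a<M , fromℕ< (m%n<n J M) , ≈-trans e (+-cong (≈-refl {w₀}) (*-reduce J))

  Fin⇒isLeftLetter : ∀ {a} → a < M × IsLeftLetterFin a → IsLeftLetter a
  Fin⇒isLeftLetter (a<M , j , e) = toℕ j , a<M , e

  isRightLetter⇒Fin : ∀ {c} → IsRightLetter c → c < M × IsRightLetterFin c
  isRightLetter⇒Fin {c} (J , c<M , e) = c<M , fromℕ< (m%n<n J M) , ≈-trans e (+-cong (≈-refl {c}) (*-reduce J))

  Fin⇒isRightLetter : ∀ {c} → c < M × IsRightLetterFin c → IsRightLetter c
  Fin⇒isRightLetter (c<M , j , e) = toℕ j , c<M , e

  rightLetter? : ∀ J c → Dec (w₀ + L ≈ c + suc b0 * J)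
  rightLetter? J c = w₀ + L ≈? c + suc b0 * J

  private
    kA : ℕ
    kA = proj₁ (hasCard-<-dec IsLeftLetterFin isLeftLetterFin? M)

    leftLetters : HasCard (λ a → a < M × IsLeftLetterFin a) kA
    leftLetters = proj₂ (hasCard-<-dec IsLeftLetterFin isLeftLetterFin? M)

  module Short (L<B : L < B) where

    OtherRightLetter : ℕ → Set
    OtherRightLetter c = IsRightLetterFin c × ¬ (w₀ + L ≈ c + suc b0 * 0)

    private
      kC : ℕ
      kC = proj₁ (hasCard-<-dec OtherRightLetter (λ c → isRightLetterFin? c ×-dec ¬? (rightLetter? 0 c)) M)

      otherRightLetters : HasCard (λ c → c < M × OtherRightLetter c) kC
      otherRightLetters = proj₂ (hasCard-<-dec OtherRightLetter (λ c → isRightLetterFin? c ×-dec ¬? (rightLetter? 0 c)) M)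

      realise-J-0′ : ∀ {a c} → a < M × IsLeftLetterFin a → RightLetter 0 c → InL B M (a ∷ w ++ [ c ])
      realise-J-0′ {a} {c} la right = let (J , left) = Fin⇒isLeftLetter la in realise-J-0 L<B J a c left right

      realise-0-J′ : ∀ {a c} → LeftLetter 0 a → c < M × OtherRightLetter c → InL B M (a ∷ w ++ [ c ])
      realise-0-J′ {a} {c} left (c<M , rc , _) = let (J , right) = Fin⇒isRightLetter (c<M , rc) in realise-0-J L<B J a c left right

    lext : HasCard (Lext B M w) kA
    lext = hasCard-⇔ (λ a la → proj₁ la , InL-∷ʳ⁻ (a ∷ w) c₀ (realise-J-0′ la right₀))
                     (λ a (_ , inl) → isLeftLetter⇒Fin (lext⇒isLeftLetter a inl)) leftLetters

    rext : HasCard (Rext B M w) (kC + 1)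
    rext = hasCard-⇔ to′ from′ (hasCard-⊎ disjoint otherRightLetters (hasCard-≡ c₀))
      where
      disjoint : ∀ c → c < M × OtherRightLetter c → c ≡ c₀ → ⊥
      disjoint c (_ , _ , ¬right₀) refl = ¬right₀ (proj₂ right₀)
      to′ : ∀ c → (c < M × OtherRightLetter c) ⊎ c ≡ c₀ → Rext B M w c
      to′ c (inj₁ rc) = proj₁ rc , InL-∷⁻ a₀ (w ++ [ c ]) (realise-0-J′ left₀ rc)
      to′ c (inj₂ refl) = proj₁ right₀ , InL-∷⁻ a₀ (w ++ [ c₀ ]) (realise-J-0 L<B 0 a₀ c₀ left₀ right₀)
      from′ : ∀ c → Rext B M w c → (c < M × OtherRightLetter c) ⊎ c ≡ c₀
      from′ c (c<M , inl) with rightLetter? 0 c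
      ... | yes e = inj₂ (rightLetter-unique (c<M , e) right₀)
      ... | no ¬e = inj₁ (c<M , proj₂ (isRightLetter⇒Fin (rext⇒isRightLetter c inl)) , ¬e)

    bext : HasCard (Bext B M w) (kA + kC)
    bext = hasCard-⇔ to′ from′ (hasCard-⊎ disjoint
             (hasCard-×≡ c₀ leftLetters)
             (hasCard-≡× a₀ otherRightLetters))
      where
      ViaLeft ViaRight : ℕ × ℕ → Set
      ViaLeft (a , c) = (a < M × IsLeftLetterFin a) × c ≡ c₀
      ViaRight (a , c) = a ≡ a₀ × (c < M × OtherRightLetter c)
      disjoint : ∀ p → ViaLeft p → ViaRight p → ⊥
      disjoint (a , c) (_ , refl) (_ , _ , _ , ¬right₀) = ¬right₀ (proj₂ right₀)
      to′ : ∀ p → ViaLeft p ⊎ ViaRight p → Bext B M w p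
      to′ (a , c) (inj₁ (la , refl)) = proj₁ la , proj₁ right₀ , realise-J-0′ la right₀
      to′ (a , c) (inj₂ (refl , rc)) = proj₁ left₀ , proj₁ rc , realise-0-J′ left₀ rc
      from′ : ∀ p → Bext B M w p → ViaLeft p ⊎ ViaRight p
      from′ (a , c) (a<M , c<M , inl) with bext-short L<B a c inl
      ... | inj₁ (la , right) = inj₁ (isLeftLetter⇒Fin la , rightLetter-unique right right₀)
      ... | inj₂ (left , rc) with rightLetter? 0 c
      ... | yes e = inj₁ (isLeftLetter⇒Fin (0 , left) , rightLetter-unique (c<M , e) right₀)
      ... | no ¬e = inj₂ (leftLetter-unique left left₀ , c<M , proj₂ (isRightLetter⇒Fin rc) , ¬e)

    pext : PextCard B M x w 1
    pext = hasCard-1 a₀ (proj₁ left₀ , realise-J-0 L<B 0 a₀ (ψ a₀) left₀ (left⇒right-ψ left₀)) unique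
      where
      unique : ∀ a → Pext B M x w a → a ≡ a₀
      unique a (a<M , inl) with bext-short L<B a (ψ a) inl
      ... | inj₁ (_ , right) = leftLetter-unique (right-ψ⇒left a<M right) left₀
      ... | inj₂ (left , _) = leftLetter-unique left left₀

    bilOrder×pextCard : BilOrder B M w 0ℤ × PextCard B M x w 1
    bilOrder×pextCard = (kA + kC , kA , kC + 1 , bext , lext , rext , bilateral) , pext
      where
      bilateral : ℤ.+ (kA + kC) ℤ.- ℤ.+ kA ℤ.- ℤ.+ (kC + 1) ℤ.+ 1ℤ ≡ 0ℤ
      bilateral rewrite pos-+ kA kC | pos-+ kC 1 = ring (ℤ.+ kA) (ℤ.+ kC)
        where
        ring : ∀ (a c : ℤ) → a ℤ.+ c ℤ.- a ℤ.- (c ℤ.+ 1ℤ) ℤ.+ 1ℤ ≡ 0ℤ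
        ring = ℤ-Solver.solve-∀

  module Base (L≡B : L ≡ B) where

    OtherRightLetter : ℕ → Set
    OtherRightLetter c = IsRightLetterFin c × ¬ (w₀ + L ≈ c + suc b0 * 1)

    private
      kC : ℕ
      kC = proj₁ (hasCard-<-dec OtherRightLetter (λ c → isRightLetterFin? c ×-dec ¬? (rightLetter? 1 c)) M)

      otherRightLetters : HasCard (λ c → c < M × OtherRightLetter c) kC
      otherRightLetters = proj₂ (hasCard-<-dec OtherRightLetter (λ c → isRightLetterFin? c ×-dec ¬? (rightLetter? 1 c)) M)

      realise-J-1′ : ∀ {a c} → a < M × IsLeftLetterFin a → RightLetter 1 c → InL B M (a ∷ w ++ [ c ])
      realise-J-1′ {a} {c} la right = let (J , left) = Fin⇒isLeftLetter la in realise-J-1 L≡B J a c left right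

      realise-1-J′ : ∀ {a c} → LeftLetter 1 a → c < M × OtherRightLetter c → InL B M (a ∷ w ++ [ c ])
      realise-1-J′ {a} {c} left (c<M , rc , _) = let (J , right) = Fin⇒isRightLetter (c<M , rc) in realise-1-J L≡B J a c left right

      realise-0-0′ : ∀ a c → LeftLetter 0 a → RightLetter 0 c → InL B M (a ∷ w ++ [ c ])
      realise-0-0′ = realise-0-0 (≤-reflexive (sym L≡B)) (subst (_≤ suc b0 + suc b0) (sym L≡B) (s≤s (m≤n+m (suc b0) b0)))

    lext : HasCard (Lext B M w) kA
    lext = hasCard-⇔ (λ a la → proj₁ la , InL-∷ʳ⁻ (a ∷ w) c₁ (realise-J-1′ la right₁))
                     (λ a (_ , inl) → isLeftLetter⇒Fin (lext⇒isLeftLetter a inl)) leftLetters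

    rext : HasCard (Rext B M w) (kC + 1)
    rext = hasCard-⇔ to′ from′ (hasCard-⊎ disjoint otherRightLetters (hasCard-≡ c₁))
      where
      disjoint : ∀ c → c < M × OtherRightLetter c → c ≡ c₁ → ⊥
      disjoint c (_ , _ , ¬right₁) refl = ¬right₁ (proj₂ right₁)
      to′ : ∀ c → (c < M × OtherRightLetter c) ⊎ c ≡ c₁ → Rext B M w c
      to′ c (inj₁ rc) = proj₁ rc , InL-∷⁻ a₁ (w ++ [ c ]) (realise-1-J′ left₁ rc)
      to′ c (inj₂ refl) = proj₁ right₁ , InL-∷⁻ a₀ (w ++ [ c₁ ]) (realise-J-1 L≡B 0 a₀ c₁ left₀ right₁)
      from′ : ∀ c → Rext B M w c → (c < M × OtherRightLetter c) ⊎ c ≡ c₁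
      from′ c (c<M , inl) with rightLetter? 1 c
      ... | yes e = inj₂ (rightLetter-unique (c<M , e) right₁)
      ... | no ¬e = inj₁ (c<M , proj₂ (isRightLetter⇒Fin (rext⇒isRightLetter c inl)) , ¬e)

    bext : HasCard (Bext B M w) (kA + (kC + 1))
    bext = hasCard-⇔ to′ from′ (hasCard-⊎ disjoint
             (hasCard-×≡ c₁ leftLetters)
             (hasCard-⊎ disjoint′
               (hasCard-≡× a₁ otherRightLetters)
               (hasCard-≡ (a₀ , c₀))))
      where
      ViaLeft ViaRight : ℕ × ℕ → Set
      ViaLeft (a , c) = (a < M × IsLeftLetterFin a) × c ≡ c₁
      ViaRight (a , c) = a ≡ a₁ × (c < M × OtherRightLetter c)
      disjoint : ∀ p → ViaLeft p → ViaRight p ⊎ p ≡ (a₀ , c₀) → ⊥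
      disjoint (a , c) (_ , refl) (inj₁ (_ , _ , _ , ¬right₁)) = ¬right₁ (proj₂ right₁)
      disjoint (a , c) (_ , refl) (inj₂ e) = c₁≢c₀ (cong proj₂ e)
      disjoint′ : ∀ p → ViaRight p → p ≡ (a₀ , c₀) → ⊥
      disjoint′ (a , c) (refl , _) e = a₁≢a₀ (cong proj₁ e)
      to′ : ∀ p → ViaLeft p ⊎ (ViaRight p ⊎ p ≡ (a₀ , c₀)) → Bext B M w p
      to′ (a , c) (inj₁ (la , refl)) = proj₁ la , proj₁ right₁ , realise-J-1′ la right₁
      to′ (a , c) (inj₂ (inj₁ (refl , rc))) = proj₁ left₁ , proj₁ rc , realise-1-J′ left₁ rc
      to′ (a , c) (inj₂ (inj₂ refl)) = proj₁ left₀ , proj₁ right₀ , realise-0-0′ a₀ c₀ left₀ right₀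
      from′ : ∀ p → Bext B M w p → ViaLeft p ⊎ (ViaRight p ⊎ p ≡ (a₀ , c₀))
      from′ (a , c) (a<M , c<M , inl) with bext-B L≡B a c inl
      ... | inj₁ (la , right) = inj₁ (isLeftLetter⇒Fin la , rightLetter-unique right right₁)
      ... | inj₂ (inj₂ (left , right)) = inj₂ (inj₂ (cong₂ _,_ (leftLetter-unique left left₀) (rightLetter-unique right right₀)))
      ... | inj₂ (inj₁ (left , rc)) with rightLetter? 1 c
      ... | yes e = inj₁ (isLeftLetter⇒Fin (1 , left) , rightLetter-unique (c<M , e) right₁)
      ... | no ¬e = inj₂ (inj₁ (leftLetter-unique left left₁ , c<M , proj₂ (isRightLetter⇒Fin rc) , ¬e))

    pext : PextCard B M x w 2
    pext = hasCard-⇔ to′ from′ (hasCard-⊎ (λ a e₁ e₀ → a₁≢a₀ (trans (sym e₁) e₀)) (hasCard-≡ a₁) (hasCard-≡ a₀))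
      where
      to′ : ∀ a → a ≡ a₁ ⊎ a ≡ a₀ → Pext B M x w a
      to′ a (inj₁ refl) = proj₁ left₁ , realise-J-1 L≡B 1 a₁ (ψ a₁) left₁ (left⇒right-ψ left₁)
      to′ a (inj₂ refl) = proj₁ left₀ , realise-0-0′ a₀ (ψ a₀) left₀ (left⇒right-ψ left₀)
      from′ : ∀ a → Pext B M x w a → a ≡ a₁ ⊎ a ≡ a₀
      from′ a (a<M , inl) with bext-B L≡B a (ψ a) inl
      ... | inj₁ (_ , right) = inj₁ (leftLetter-unique (right-ψ⇒left a<M right) left₁)
      ... | inj₂ (inj₁ (left , _)) = inj₁ (leftLetter-unique left left₁)
      ... | inj₂ (inj₂ (left , _)) = inj₂ (leftLetter-unique left left₀)

    bilOrder×pextCard : BilOrder B M w 1ℤ × PextCard B M x w 2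
    bilOrder×pextCard = (kA + (kC + 1) , kA , kC + 1 , bext , lext , rext , bilateral) , pext
      where
      bilateral : ℤ.+ (kA + (kC + 1)) ℤ.- ℤ.+ kA ℤ.- ℤ.+ (kC + 1) ℤ.+ 1ℤ ≡ 1ℤ
      bilateral rewrite pos-+ kA (kC + 1) | pos-+ kC 1 = ring (ℤ.+ kA) (ℤ.+ kC)
        where
        ring : ∀ (a c : ℤ) → a ℤ.+ (c ℤ.+ 1ℤ) ℤ.- a ℤ.- (c ℤ.+ 1ℤ) ℤ.+ 1ℤ ≡ 1ℤ
        ring = ℤ-Solver.solve-∀

  module Longer (B<L : B < L) (L<2B : L < B + B) where

    open Long b-1≉0 B<L L<2B

    lext : HasCard (Lext B M w) 2
    lext = hasCard-⇔ to′ from′ (hasCard-⊎ (λ a e₁ e₀ → a₁≢a₀ (trans (sym e₁) e₀)) (hasCard-≡ a₁) (hasCard-≡ a₀))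
      where
      to′ : ∀ a → a ≡ a₁ ⊎ a ≡ a₀ → Lext B M w a
      to′ a (inj₁ refl) = proj₁ left₁ , InL-∷ʳ⁻ (a₁ ∷ w) c₀ (realise-1-0 B<L L<2B a₁ c₀ left₁ right₀)
      to′ a (inj₂ refl) = proj₁ left₀ , InL-∷ʳ⁻ (a₀ ∷ w) c₁ (realise-0-1 B<L L<2B a₀ c₁ left₀ right₁)
      from′ : ∀ a → Lext B M w a → a ≡ a₁ ⊎ a ≡ a₀
      from′ a (_ , inl) with lext-long a inl
      ... | inj₁ left = inj₁ (leftLetter-unique left left₁)
      ... | inj₂ left = inj₂ (leftLetter-unique left left₀)

    rext : HasCard (Rext B M w) 2
    rext = hasCard-⇔ to′ from′ (hasCard-⊎ (λ c e₁ e₀ → c₁≢c₀ (trans (sym e₁) e₀)) (hasCard-≡ c₁) (hasCard-≡ c₀))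
      where
      to′ : ∀ c → c ≡ c₁ ⊎ c ≡ c₀ → Rext B M w c
      to′ c (inj₁ refl) = proj₁ right₁ , InL-∷⁻ a₀ (w ++ [ c₁ ]) (realise-0-1 B<L L<2B a₀ c₁ left₀ right₁)
      to′ c (inj₂ refl) = proj₁ right₀ , InL-∷⁻ a₁ (w ++ [ c₀ ]) (realise-1-0 B<L L<2B a₁ c₀ left₁ right₀)
      from′ : ∀ c → Rext B M w c → c ≡ c₁ ⊎ c ≡ c₀
      from′ c (_ , inl) with rext-long c inl
      ... | inj₁ right = inj₁ (rightLetter-unique right right₁)
      ... | inj₂ right = inj₂ (rightLetter-unique right right₀)

    module UpTo2B-2 (L≤ : L ≤ suc b0 + suc b0) where

      private
        realise-0-0′ : ∀ a c → LeftLetter 0 a → RightLetter 0 c → InL B M (a ∷ w ++ [ c ])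
        realise-0-0′ = realise-0-0 (<⇒≤ B<L) L≤

      bext : HasCard (Bext B M w) 3
      bext = hasCard-⇔ to′ from′
        (hasCard-⊎ disjoint (hasCard-≡ (a₁ , c₀))
          (hasCard-⊎ (λ p e₁ e₀ → c₁≢c₀ (cong proj₂ (trans (sym e₁) e₀)))
                     (hasCard-≡ (a₀ , c₁)) (hasCard-≡ (a₀ , c₀))))
        where
        disjoint : ∀ p → p ≡ (a₁ , c₀) → p ≡ (a₀ , c₁) ⊎ p ≡ (a₀ , c₀) → ⊥
        disjoint p e₁ (inj₁ e₀) = a₁≢a₀ (cong proj₁ (trans (sym e₁) e₀))
        disjoint p e₁ (inj₂ e₀) = a₁≢a₀ (cong proj₁ (trans (sym e₁) e₀))
        to′ : ∀ p → p ≡ (a₁ , c₀) ⊎ (p ≡ (a₀ , c₁) ⊎ p ≡ (a₀ , c₀)) → Bext B M w p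
        to′ p (inj₁ refl) = proj₁ left₁ , proj₁ right₀ , realise-1-0 B<L L<2B a₁ c₀ left₁ right₀
        to′ p (inj₂ (inj₁ refl)) = proj₁ left₀ , proj₁ right₁ , realise-0-1 B<L L<2B a₀ c₁ left₀ right₁
        to′ p (inj₂ (inj₂ refl)) = proj₁ left₀ , proj₁ right₀ , realise-0-0′ a₀ c₀ left₀ right₀
        from′ : ∀ p → Bext B M w p → p ≡ (a₁ , c₀) ⊎ (p ≡ (a₀ , c₁) ⊎ p ≡ (a₀ , c₀))
        from′ (a , c) (_ , _ , inl) with bext-long a c inl
        ... | inj₁ (left , right) = inj₁ (cong₂ _,_ (leftLetter-unique left left₁) (rightLetter-unique right right₀))
        ... | inj₂ (inj₁ (left , right)) = inj₂ (inj₁ (cong₂ _,_ (leftLetter-unique left left₀) (rightLetter-unique right right₁)))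
        ... | inj₂ (inj₂ (left , right)) = inj₂ (inj₂ (cong₂ _,_ (leftLetter-unique left left₀) (rightLetter-unique right right₀)))

      pext : PextCard B M x w 1
      pext = hasCard-1 a₀ (proj₁ left₀ , realise-0-0′ a₀ (ψ a₀) left₀ (left⇒right-ψ left₀)) unique
        where
        unique : ∀ a → Pext B M x w a → a ≡ a₀
        unique a (a<M , inl) with bext-long a (ψ a) inl
        ... | inj₁ (_ , right) = leftLetter-unique (right-ψ⇒left a<M right) left₀
        ... | inj₂ (inj₁ (left , _)) = leftLetter-unique left left₀
        ... | inj₂ (inj₂ (left , _)) = leftLetter-unique left left₀

      bilOrder×pextCard : BilOrder B M w 0ℤ × PextCard B M x w 1
      bilOrder×pextCard = (3 , 2 , 2 , bext , lext , rext , refl) , pext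

    module Is2B-1 (L≡ : L ≡ suc b0 + B) where

      bext : HasCard (Bext B M w) 2
      bext = hasCard-⇔ to′ from′
        (hasCard-⊎ (λ p e₁ e₀ → a₁≢a₀ (cong proj₁ (trans (sym e₁) e₀))) (hasCard-≡ (a₁ , c₀)) (hasCard-≡ (a₀ , c₁)))
        where
        to′ : ∀ p → p ≡ (a₁ , c₀) ⊎ p ≡ (a₀ , c₁) → Bext B M w p
        to′ p (inj₁ refl) = proj₁ left₁ , proj₁ right₀ , realise-1-0 B<L L<2B a₁ c₀ left₁ right₀
        to′ p (inj₂ refl) = proj₁ left₀ , proj₁ right₁ , realise-0-1 B<L L<2B a₀ c₁ left₀ right₁
        from′ : ∀ p → Bext B M w p → p ≡ (a₁ , c₀) ⊎ p ≡ (a₀ , c₁)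
        from′ (a , c) (_ , _ , inl) with bext-2B-1 L≡ a c inl
        ... | inj₁ (left , right) = inj₁ (cong₂ _,_ (leftLetter-unique left left₁) (rightLetter-unique right right₀))
        ... | inj₂ (left , right) = inj₂ (cong₂ _,_ (leftLetter-unique left left₀) (rightLetter-unique right right₁))

      pext : PextCard B M x w 0
      pext = hasCard-0 none
        where
        none : ∀ a → ¬ Pext B M x w a
        none a (a<M , inl) with bext-2B-1 L≡ a (ψ a) inl
        ... | inj₁ (left , right) = ¬leftLetter-0-1 (right-ψ⇒left a<M right) left
        ... | inj₂ (left , right) = ¬leftLetter-0-1 left (right-ψ⇒left a<M right)

      bilOrder×pextCard : BilOrder B M w -1ℤ × PextCard B M x w 0
      bilOrder×pextCard = (2 , 2 , 2 , bext , lext , rext , refl) , pext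

lemma2 : (b m : ℕ) → 2 ≤ b → 1 ≤ m → modℕ m b ≢ modℕ m 1
    → (w : List ℕ) → Bispecial b m w → 1 ≤ length w → length w < 2 * b
    → (x : ℕ) → x < m → Ψ m x w ≡ w
    → ((1 ≤ length w → length w ≤ b ∸ 1 → BilOrder b m w 0ℤ × PextCard b m x w 1)
      × (length w ≡ b → BilOrder b m w 1ℤ × PextCard b m x w 2)
      × (suc b ≤ length w → length w ≤ 2 * b ∸ 2 → BilOrder b m w 0ℤ × PextCard b m x w 1)
      × (length w ≡ 2 * b ∸ 1 → BilOrder b m w -1ℤ × PextCard b m x w 0))
lemma2 (suc (suc b0)) (suc m0) (s≤s (s≤s z≤n)) (s≤s z≤n) _ [] _ () _ _ _ _
lemma2 (suc (suc b0)) (suc m0) (s≤s (s≤s z≤n)) (s≤s z≤n) B≢1 (y ∷ ys) bispecial _ |w|<2B x _ fixed =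
    (λ _ |w|≤b-1 → Short.bilOrder×pextCard (s≤s |w|≤b-1))
  , (λ |w|≡B → Base.bilOrder×pextCard |w|≡B)
  , (λ B<|w| |w|≤2b-2 → Longer.UpTo2B-2.bilOrder×pextCard B<|w| |w|<B+B (subst (length w ≤_) 2B∸2≡ |w|≤2b-2))
  , (λ |w|≡2b-1 → let |w|≡ = trans |w|≡2b-1 2B∸1≡ in
                   Longer.Is2B-1.bilOrder×pextCard (subst (B <_) (sym |w|≡) (m<n+m B (s≤s z≤n))) |w|<B+B |w|≡)
  where
  open ThueMorse b0 m0
  w = y ∷ ys
  |w|<B+B : length w < B + B
  |w|<B+B = subst (length w <_) (cong (B +_) (+-identityʳ B)) |w|<2B
  2B∸1≡ : 2 * B ∸ 1 ≡ suc b0 + B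
  2B∸1≡ = cong (suc b0 +_) (+-identityʳ B)
  2B∸2≡ : 2 * B ∸ 2 ≡ suc b0 + suc b0
  2B∸2≡ = trans (cong (b0 +_) (+-identityʳ B)) (+-suc b0 (suc b0))
  w<M : ∀ j → j < length w → nth w j < M
  w<M = InL⇒nth<M w (proj₁ bispecial)
  open Counting b0 m0 w (length ys) refl (bispecial⇒ascending w (length ys) refl |w|<B+B bispecial) w<M
                (B≉1⇒B-1≉0 b0 B≢1) x (Ψ-fixed⇒≈ x y ys fixed (w<M (length ys) ≤-refl))
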